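{- Let $G=(V,E)$ be a graph and let $\mathcal{M}$ be a nontrivial, unbounded graph matroid family with rank function $r$, dimensionality $d$ and threshold $t$. Let $k$ be an integer with $k\ge t$. If $\mathcal{M}(G)$ is vertically $(r(K_k)+2)$-connected, then $G$ is $(k+1)$-connected.
   Context: All graphs are finite and simple, without isolated vertices. A graph matroid family $\mathcal{M}$ assigns to every graph $G$ a matroid $\mathcal{M}(G)$ on $E(G)$ such that (i) every graph isomorphism $\varphi:V(G)\to V(H)$ induces, via $uv\mapsto\varphi(u)\varphi(v)$, an isomorphism $\mathcal{M}(G)\to\mathcal{M}(H)$, and (ii) for every subgraph $H$ of $G$, $\mathcal{M}(H)$ is the restriction of $\mathcal{M}(G)$ to $E(H)$. $r(G)$ is the rank of $\mathcal{M}(G)$; $K_k$ is the complete graph on $k$ vertices. $G$ is $\mathcal{M}$-independent if $r(G)=|E(G)|$ and an $\mathcal{M}$-circuit if not $\mathcal{M}$-independent but $G-e$ is for all $e\in E(G)$. $\mathcal{M}$ is trivial if every graph is $\mathcal{M}$-independent; unbounded if $r(K_n)$ is unbounded in $n$. For nontrivial $\mathcal{M}$, the dimensionality is $d=\min\{d':\exists\ \mathcal{M}\text{ -circuit with minimum degree } d'+1\}$ and the threshold is $t=\min\{|V(C)|-1: C\text{ an }\mathcal{M}\text{ -circuit of minimum degree } d+1\}$. For a matroid $(E,r)$, a vertical $k$-separation is a bipartition $(E_1,E_2)$ of $E$ with $r(E_1),r(E_2)\ge k$ and $r(E_1)+r(E_2)\le r(E)+k-1$; the matroid is vertically $k$-connected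 if $k\le r(E)$ and it has no vertical $k'$-separation for any positive integer $k'<k$. -}

module Defs where

open import Data.Nat as ℕ using (ℕ; zero; suc; _+_; _≤_; _<_)
open import Data.Fin as Fin using (Fin)
open import Data.Fin.Properties using () renaming (_≟_ to _≟ᶠ_)
open import Data.Fin.Subset using (Subset; ⊤; ⊥; ∁; _∩_; _∪_; _⊆_; _∈_; _∉_; ∣_∣; ⁅_⁆; _-_)
open import Data.Vec using (_∷_; []; tabulate)
open import Data.Bool using (Bool; true; false; _∨_)
open import Data.Product using (Σ; ∃; ∃-syntax; _×_; _,_; proj₁; proj₂)
open import Data.Sum using (_⊎_)
open import Relation.Nullary using (¬_; Dec; yes; no; does)
open import Relation.Binary.PropositionalEquality using (_≡_)
open import Function.Definitions using (Injective)

-- Vertex set Fin n, edge set Fin m; edge e joins proj₁ (ends e) < proj₂ (ends e)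
-- (so no loops); distinct edges have distinct endpoint pairs (no parallel edges).
-- Isolated vertices are allowed in this carrier type; the paper's standing
-- convention "no isolated vertices" is imposed by the predicate NoIsolated.

record Graph : Set where
  field
    n       : ℕ
    m       : ℕ
    ends    : Fin m → Fin n × Fin n
    ordered : ∀ e → proj₁ (ends e) Fin.< proj₂ (ends e)
    simple  : Injective _≡_ _≡_ ends

open Graph public

Joins : (G : Graph) → Fin (m G) → Fin (n G) → Fin (n G) → Set
Joins G e u v = ends G e ≡ (u , v) ⊎ ends G e ≡ (v , u)

Adj : (G : Graph) → Fin (n G) → Fin (n G) → Set
Adj G u v = ∃[ e ] Joins G e u v

incident : (G : Graph) → Fin (n G) → Subset (m G)
incident G v = tabulate (λ e → does (proj₁ (ends G e) ≟ᶠ v) ∨ does (proj₂ (ends G e) ≟ᶠ v))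

degree : (G : Graph) → Fin (n G) → ℕ
degree G v = ∣ incident G v ∣

NoIsolated : Graph → Set
NoIsolated G = ∀ v → 1 ≤ degree G v

MinDegree : Graph → ℕ → Set
MinDegree G δ = (∀ v → δ ≤ degree G v) × (∃[ v ] degree G v ≡ δ)

IsComplete : Graph → Set
IsComplete G = ∀ (u v : Fin (n G)) → u Fin.< v → ∃[ e ] ends G e ≡ (u , v)

-- An embedding H → G is the composite of an isomorphism of H onto a subgraph
-- of G with the inclusion; edgeMap is the induced map uv ↦ φ(u)φ(v).

record Embedding (H G : Graph) : Set where
  field
    vmap     : Fin (n H) → Fin (n G)
    vmap-inj : Injective _≡_ _≡_ vmap
    emap     : Fin (m H) → Fin (m G)
    emap-ok  : ∀ e → Joins G (emap e) (vmap (proj₁ (ends H e))) (vmap (proj₂ (ends H e)))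

open Embedding public

image : ∀ {a b} → (Fin a → Fin b) → Subset a → Subset b
image {zero}  f []          = ⊥
image {suc a} f (true ∷ X)  = ⁅ f Fin.zero ⁆ ∪ image (λ i → f (Fin.suc i)) X
image {suc a} f (false ∷ X) = image (λ i → f (Fin.suc i)) X

record IsMatroidRank {E : ℕ} (r : Subset E → ℕ) : Set where
  field
    bounded    : ∀ X → r X ≤ ∣ X ∣
    monotone   : ∀ X Y → X ⊆ Y → r X ≤ r Y
    submodular : ∀ X Y → r (X ∪ Y) + r (X ∩ Y) ≤ r X + r Y

-- vertical k-separation (E₁ = X, E₂ = complement of X)
VerticalSeparation : ∀ {E} → (Subset E → ℕ) → ℕ → Subset E → Set
VerticalSeparation r k X =
  k ≤ r X × k ≤ r (∁ X) × r X + r (∁ X) + 1 ≤ r ⊤ + k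

VerticallyConnected : ∀ {E} → (Subset E → ℕ) → ℕ → Set
VerticallyConnected r k =
  k ≤ r ⊤ × (∀ k' X → 1 ≤ k' → k' < k → ¬ VerticalSeparation r k' X)

-- Axioms (i)+(ii) combined: for every embedding H → G (isomorphism onto a
-- subgraph), M(H) is mapped by the induced edge map onto the restriction of
-- M(G) to the image, i.e. rank is preserved.

record GraphMatroidFamily : Set where
  field
    rank     : (G : Graph) → Subset (m G) → ℕ
    matroid  : ∀ G → IsMatroidRank (rank G)
    compat   : ∀ H G (φ : Embedding H G) (X : Subset (m H)) →
               rank H X ≡ rank G (image (emap φ) X)

  r : Graph → ℕ
  r G = rank G ⊤

  Independent : Graph → Set
  Independent G = r G ≡ m G

  -- C is an M-circuit: not independent, but C - e independent for all e
  -- (independence of C - e is independence of E(C) - e in M(C), by (ii))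
  Circuit : Graph → Set
  Circuit C = ¬ Independent C × (∀ e → rank C (⊤ - e) ≡ ∣ ⊤ {m C} - e ∣)

  Trivial : Set
  Trivial = ∀ G → NoIsolated G → Independent G

  Nontrivial : Set
  Nontrivial = ¬ Trivial

  Unbounded : Set
  Unbounded = ∀ B → ∃[ K ] IsComplete K × B < r K

  IsDimensionality : ℕ → Set
  IsDimensionality d =
    (∃[ C ] Circuit C × MinDegree C (suc d)) ×
    (∀ C d' → Circuit C → MinDegree C (suc d') → d ≤ d')

  IsThreshold : ℕ → ℕ → Set
  IsThreshold d t =
    (∃[ C ] Circuit C × MinDegree C (suc d) × n C ≡ suc t) ×
    (∀ C → Circuit C → MinDegree C (suc d) → suc t ≤ n C)

open GraphMatroidFamily public

data Reach (G : Graph) (S : Subset (n G)) : Fin (n G) → Fin (n G) → Set where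
  here : ∀ {u} → Reach G S u u
  step : ∀ {u w v} → Adj G u w → w ∉ S → Reach G S w v → Reach G S u v

KConnected : Graph → ℕ → Set
KConnected G k =
  k < n G × (∀ (S : Subset (n G)) → ∣ S ∣ < k → ∀ u v → u ∉ S → v ∉ S → Reach G S u v)

{-# OPTIONS --safe #-}
-- Suppose S is a set of at most k vertices and A a union of components of G − S missing some vertex
-- outside S, and let X be the edges meeting A. Embed G in a complete graph H of large rank (M is unbounded),
-- choose T ⊇ S with |T| = k, and let U₁, U₂ be the host vertices outside T that lie in A resp. not in A.
-- X lies in the clique on T ∪ U₁ and E − X in the clique on T ∪ U₂. A circuit of minimum degree d + 1 on
-- t + 1 ≤ k + 1 vertices shows that d edges from a new vertex into a clique of size ≥ t span all edges from
-- it into that clique, so each of these cliques has rank at most r(K_k) + d|Uᵢ|. Conversely every circuit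
-- has minimum degree ≥ d + 1, so d edges at a vertex that is otherwise untouched are coloops, and the union
-- of the two cliques has rank at least r(K_k) + d(|U₁| + |U₂|). Submodularity then yields
-- r(X) + r(E − X) ≤ r(G) + r(K_k), a vertical separation of order at most r(K_k) + 1 as soon as both sides
-- have rank below r(G), which the low-degree coloops guarantee. If G has at most k + 1 vertices, take
-- A a single vertex and S the others.
module Submission where

open import Data.Bool using (Bool; true; false)
open import Data.Fin as Fin using (Fin)
import Data.Fin.Properties as Finₚ
open import Data.Fin.Subset
open import Data.Fin.Subset.Properties
open import Data.Fin.Subset.Induction using (⊂-wellFounded; ⊃-wellFounded)
open import Data.Nat.Solver using (module +-*-Solver)
open import Data.Nat using (ℕ; zero; suc; _+_; _*_; _≤_; _<_; z≤n; s≤s)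
import Data.Nat.Properties as ℕₚ
import Data.Product.Properties as ×ₚ
open import Data.Product using (∃-syntax; _×_; _,_; proj₁; proj₂)
open import Data.Sum as Sum using (_⊎_; inj₁; inj₂; [_,_]′)
open import Data.Vec using (_∷_; []; tabulate; here; there)
open import Data.Vec.Properties using (lookup⇒[]=; []=⇒lookup; lookup∘tabulate)
open import Function using (_∘_; id; case_of_)
open import Induction.WellFounded using (module All)
open import Function.Definitions using (Injective)
open import Level using (Level)
open import Relation.Binary using (tri<; tri≈; tri>)
open import Relation.Binary.PropositionalEquality
open import Relation.Nullary using (¬_; Dec; yes; no; does; contradiction; _×-dec_; _⊎-dec_; ¬?)
open import Relation.Nullary.Decidable using (dec-true)
open import Relation.Unary using (Pred; Decidable)

open import Defs

private
  variable
    ℓ : Level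
    a b k : ℕ

subsetOf : {P : Pred (Fin k) ℓ} → Decidable P → Subset k
subsetOf P? = tabulate (does ∘ P?)

∈-tabulate⁺ : (f : Fin k → Bool) {i : Fin k} → f i ≡ true → i ∈ tabulate f
∈-tabulate⁺ f {i} fi = lookup⇒[]= i (tabulate f) (trans (lookup∘tabulate f i) fi)

∈-tabulate⁻ : (f : Fin k → Bool) {i : Fin k} → i ∈ tabulate f → f i ≡ true
∈-tabulate⁻ f {i} i∈ = trans (sym (lookup∘tabulate f i)) ([]=⇒lookup i∈)

module _ {P : Pred (Fin k) ℓ} (P? : Decidable P) where

  ∈-subsetOf⁺ : ∀ {i} → P i → i ∈ subsetOf P?
  ∈-subsetOf⁺ {i} p = ∈-tabulate⁺ (does ∘ P?) (dec-true (P? i) p)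

  ∈-subsetOf⁻ : ∀ {i} → i ∈ subsetOf P? → P i
  ∈-subsetOf⁻ {i} i∈ with P? i | ∈-tabulate⁻ (does ∘ P?) i∈
  ... | yes p | _ = p

x∈p-y⇒x∈p : ∀ {p : Subset k} {x y} → x ∈ p - y → x ∈ p
x∈p-y⇒x∈p = p─q⊆p _ _

x∈p─q⇒x∉q : ∀ (p q : Subset k) {x} → x ∈ p ─ q → x ∉ q
x∈p─q⇒x∉q (true  ∷ p) (false ∷ q) here       ()
x∈p─q⇒x∉q (_     ∷ p) (_     ∷ q) (there x∈) (there x∈q) = x∈p─q⇒x∉q p q x∈ x∈q

x∈p-y⇒x≢y : ∀ {p : Subset k} {x y} → x ∈ p - y → x ≢ y
x∈p-y⇒x≢y {p = p} {y = y} x∈ refl = x∈p─q⇒x∉q p ⁅ y ⁆ x∈ (x∈⁅x⁆ y)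

∪-least : {p q r : Subset k} → p ⊆ r → q ⊆ r → p ∪ q ⊆ r
∪-least {p = p} {q} p⊆r q⊆r x∈ = [ p⊆r , q⊆r ]′ (x∈p∪q⁻ p q x∈)

∪-mono : {p p′ q q′ : Subset k} → p ⊆ p′ → q ⊆ q′ → p ∪ q ⊆ p′ ∪ q′
∪-mono p⊆p′ q⊆q′ = ∪-least (p⊆p∪q _ ∘ p⊆p′) (q⊆p∪q _ _ ∘ q⊆q′)

∩-monoˡ : {p p′ q : Subset k} → p ⊆ p′ → p ∩ q ⊆ p′ ∩ q
∩-monoˡ {p = p} {q = q} p⊆p′ x∈ = let x∈p , x∈q = x∈p∩q⁻ p q x∈ in x∈p∩q⁺ (p⊆p′ x∈p , x∈q)

⊆-p-x∪⁅x⁆ : (p : Subset k) (x : Fin k) → p ⊆ (p - x) ∪ ⁅ x ⁆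
⊆-p-x∪⁅x⁆ p x {y} y∈p with y Finₚ.≟ x
... | yes refl = q⊆p∪q _ _ (x∈⁅x⁆ x)
... | no y≢x   = p⊆p∪q _ (x∈p∧x≢y⇒x∈p-y y∈p y≢x)

p-x∪⁅x⁆≡p : {p : Subset k} {x : Fin k} → x ∈ p → (p - x) ∪ ⁅ x ⁆ ≡ p
p-x∪⁅x⁆≡p {p = p} {x} x∈p =
  ⊆-antisym (∪-least x∈p-y⇒x∈p (λ y∈ → subst (_∈ p) (sym (x∈⁅y⁆⇒x≡y _ y∈)) x∈p)) (⊆-p-x∪⁅x⁆ p x)

x∈p⇒x∈q∪[∁q∩p] : ∀ {p q : Subset k} {x} → x ∈ p → x ∈ q ∪ (∁ q ∩ p)
x∈p⇒x∈q∪[∁q∩p] {q = q} {x} x∈p with x ∈? q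
... | yes x∈q = p⊆p∪q _ x∈q
... | no x∉q  = q⊆p∪q _ _ (x∈p∩q⁺ (x∉p⇒x∈∁p x∉q , x∈p))

∣p∣≡∣p∩q∣+∣p∩∁q∣ : (p q : Subset k) → ∣ p ∣ ≡ ∣ p ∩ q ∣ + ∣ p ∩ ∁ q ∣
∣p∣≡∣p∩q∣+∣p∩∁q∣ []          []          = refl
∣p∣≡∣p∩q∣+∣p∩∁q∣ (true  ∷ p) (true  ∷ q) = cong suc (∣p∣≡∣p∩q∣+∣p∩∁q∣ p q)
∣p∣≡∣p∩q∣+∣p∩∁q∣ (true  ∷ p) (false ∷ q) =
  trans (cong suc (∣p∣≡∣p∩q∣+∣p∩∁q∣ p q)) (sym (ℕₚ.+-suc _ _))
∣p∣≡∣p∩q∣+∣p∩∁q∣ (false ∷ p) (_     ∷ q) = ∣p∣≡∣p∩q∣+∣p∩∁q∣ p q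

∣p∣+∣∁p∣≡n : (p : Subset k) → ∣ p ∣ + ∣ ∁ p ∣ ≡ k
∣p∣+∣∁p∣≡n []          = refl
∣p∣+∣∁p∣≡n (true  ∷ p) = cong suc (∣p∣+∣∁p∣≡n p)
∣p∣+∣∁p∣≡n (false ∷ p) = trans (ℕₚ.+-suc ∣ p ∣ _) (cong suc (∣p∣+∣∁p∣≡n p))

x∈p⇒suc∣p-x∣≡∣p∣ : ∀ {p : Subset k} {x} → x ∈ p → suc ∣ p - x ∣ ≡ ∣ p ∣
x∈p⇒suc∣p-x∣≡∣p∣ {p = true ∷ p} here = cong (suc ∘ ∣_∣) (p─⊥≡p p)
x∈p⇒suc∣p-x∣≡∣p∣ {p = true  ∷ p} (there x∈p) = cong suc (x∈p⇒suc∣p-x∣≡∣p∣ x∈p)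
x∈p⇒suc∣p-x∣≡∣p∣ {p = false ∷ p} (there x∈p) = x∈p⇒suc∣p-x∣≡∣p∣ x∈p

x∉p⇒∣p∪⁅x⁆∣≡suc∣p∣ : ∀ {p : Subset k} {x} → x ∉ p → ∣ p ∪ ⁅ x ⁆ ∣ ≡ suc ∣ p ∣
x∉p⇒∣p∪⁅x⁆∣≡suc∣p∣ {p = false ∷ p} {Fin.zero}  _   = cong (suc ∘ ∣_∣) (∪-identityʳ p)
x∉p⇒∣p∪⁅x⁆∣≡suc∣p∣ {p = true  ∷ p} {Fin.zero}  x∉p = contradiction here x∉p
x∉p⇒∣p∪⁅x⁆∣≡suc∣p∣ {p = false ∷ p} {Fin.suc x} x∉p = x∉p⇒∣p∪⁅x⁆∣≡suc∣p∣ (x∉p ∘ there)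
x∉p⇒∣p∪⁅x⁆∣≡suc∣p∣ {p = true  ∷ p} {Fin.suc x} x∉p = cong suc (x∉p⇒∣p∪⁅x⁆∣≡suc∣p∣ (x∉p ∘ there))

x∈p⇒0<∣p∣ : ∀ {p : Subset k} {x} → x ∈ p → 0 < ∣ p ∣
x∈p⇒0<∣p∣ {x = x} x∈p = ℕₚ.<-≤-trans (ℕₚ.≤-reflexive (sym (∣⁅x⁆∣≡1 x)))
  (p⊆q⇒∣p∣≤∣q∣ λ y∈ → subst (_∈ _) (sym (x∈⁅y⁆⇒x≡y _ y∈)) x∈p)

0<∣p∣⇒Nonempty : (p : Subset k) → 0 < ∣ p ∣ → Nonempty p
0<∣p∣⇒Nonempty {k} p 0<∣p∣ with nonempty? p
... | yes ne = ne
... | no ¬ne = contradiction (trans (cong ∣_∣ (Empty-unique ¬ne)) (∣⊥∣≡0 k)) (ℕₚ.m<n⇒n≢0 0<∣p∣)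

removal-induction : (P : Subset k → Set ℓ) → P ⊥ → (∀ {X x} → x ∈ X → P (X - x) → P X) → ∀ X → P X
removal-induction P base ind = All.wfRec ⊂-wellFounded _ P removeOne
  where
  removeOne : ∀ X → (∀ {Y} → Y ⊂ X → P Y) → P X
  removeOne X rec with nonempty? X
  ... | no ¬ne        = subst P (sym (Empty-unique ¬ne)) base
  ... | yes (x , x∈X) = ind x∈X (rec (x∈p⇒p-x⊂p x∈X))

⊆-ofSize : (T : Subset k) → a ≤ ∣ T ∣ → ∃[ D ] D ⊆ T × ∣ D ∣ ≡ a
⊆-ofSize {k} {zero} T _ = ⊥ , ⊥⊆ , ∣⊥∣≡0 k
⊆-ofSize {a = suc a} (true ∷ T) (s≤s a≤∣T∣) with ⊆-ofSize T a≤∣T∣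
... | D , D⊆T , ∣D∣≡a = true ∷ D , (λ { here → here ; (there x∈) → there (D⊆T x∈) }) , cong suc ∣D∣≡a
⊆-ofSize {a = suc a} (false ∷ T) a≤∣T∣ with ⊆-ofSize T a≤∣T∣
... | D , D⊆T , ∣D∣≡a = false ∷ D , (λ { (there x∈) → there (D⊆T x∈) }) , ∣D∣≡a

⊇-ofSize : (S : Subset k) → ∣ S ∣ ≤ a → a ≤ k → ∃[ T ] S ⊆ T × ∣ T ∣ ≡ a
⊇-ofSize [] _ z≤n = [] , ⊆-refl , refl
⊇-ofSize {suc k} {a} (x ∷ S) ∣S∣≤a a≤k with x | a ℕₚ.≤? k
... | false | yes a≤k′ with ⊇-ofSize S ∣S∣≤a a≤k′
...   | T , S⊆T , ∣T∣≡a = false ∷ T , (λ { (there y∈) → there (S⊆T y∈) }) , ∣T∣≡a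
⊇-ofSize {suc k} {suc a} (x ∷ S) ∣S∣≤a (s≤s a≤k) | b | no a≰k
  with ⊇-ofSize S (ℕₚ.≤-trans (∣p∣≤n S) (ℕₚ.≤-pred (ℕₚ.≰⇒> a≰k))) a≤k
...   | T , S⊆T , ∣T∣≡a = true ∷ T , (λ { here → here ; (there y∈) → there (S⊆T y∈) }) , cong suc ∣T∣≡a
⊇-ofSize {suc k} {zero} (x ∷ S) _ _ | _ | no a≰k = contradiction z≤n a≰k
⊇-ofSize {suc k} {suc a} (x ∷ S) (s≤s ∣S∣≤a) (s≤s a≤k) | true | yes _ with ⊇-ofSize S ∣S∣≤a a≤k
...   | T , S⊆T , ∣T∣≡a = true ∷ T , (λ { here → here ; (there y∈) → there (S⊆T y∈) }) , cong suc ∣T∣≡a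

argmin : (g : Fin k → ℕ) → Fin k → ∃[ v ] ∀ w → g v ≤ g w
argmin {suc zero}    g _ = Fin.zero , λ { Fin.zero → ℕₚ.≤-refl }
argmin {suc (suc k)} g _ with argmin (g ∘ Fin.suc) Fin.zero
... | v , min with g Fin.zero ℕₚ.≤? g (Fin.suc v)
...   | yes g0≤ = Fin.zero , λ { Fin.zero → ℕₚ.≤-refl ; (Fin.suc w) → ℕₚ.≤-trans g0≤ (min w) }
...   | no g0≰ = Fin.suc v , λ { Fin.zero → ℕₚ.<⇒≤ (ℕₚ.≰⇒> g0≰) ; (Fin.suc w) → min w }

enum : (S : Subset k) → Fin ∣ S ∣ → Fin k
enum (true  ∷ S) Fin.zero    = Fin.zero
enum (true  ∷ S) (Fin.suc j) = Fin.suc (enum S j)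
enum (false ∷ S) j           = Fin.suc (enum S j)

index : (S : Subset k) {i : Fin k} → i ∈ S → Fin ∣ S ∣
index (true  ∷ S) here       = Fin.zero
index (true  ∷ S) (there i∈) = Fin.suc (index S i∈)
index (false ∷ S) (there i∈) = index S i∈

enum-∈ : (S : Subset k) (j : Fin ∣ S ∣) → enum S j ∈ S
enum-∈ (true  ∷ S) Fin.zero    = here
enum-∈ (true  ∷ S) (Fin.suc j) = there (enum-∈ S j)
enum-∈ (false ∷ S) j           = there (enum-∈ S j)

enum-index : (S : Subset k) {i : Fin k} (i∈ : i ∈ S) → enum S (index S i∈) ≡ i
enum-index (true  ∷ S) here       = refl
enum-index (true  ∷ S) (there i∈) = cong Fin.suc (enum-index S i∈)
enum-index (false ∷ S) (there i∈) = cong Fin.suc (enum-index S i∈)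

enum-<-mono : (S : Subset k) {i j : Fin ∣ S ∣} → i Fin.< j → enum S i Fin.< enum S j
enum-<-mono (true  ∷ S) {Fin.zero}  {Fin.suc j} i<j       = s≤s z≤n
enum-<-mono (true  ∷ S) {Fin.suc i} {Fin.suc j} (s≤s i<j) = s≤s (enum-<-mono S i<j)
enum-<-mono (false ∷ S) i<j                               = s≤s (enum-<-mono S i<j)

enum-injective : (S : Subset k) → Injective _≡_ _≡_ (enum S)
enum-injective (true  ∷ S) {Fin.zero}  {Fin.zero}  _  = refl
enum-injective (true  ∷ S) {Fin.suc i} {Fin.suc j} eq = cong Fin.suc (enum-injective S (Finₚ.suc-injective eq))
enum-injective (false ∷ S) eq = enum-injective S (Finₚ.suc-injective eq)

index-enum : (S : Subset k) {i : Fin k} (i∈ : i ∈ S) {j : Fin ∣ S ∣} → enum S j ≡ i → index S i∈ ≡ j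
index-enum S i∈ eq = enum-injective S (trans (enum-index S i∈) (sym eq))

index-injective : (S : Subset k) {i j : Fin k} (i∈ : i ∈ S) (j∈ : j ∈ S) → index S i∈ ≡ index S j∈ → i ≡ j
index-injective S i∈ j∈ eq = trans (sym (enum-index S i∈)) (trans (cong (enum S) eq) (enum-index S j∈))

index-<-mono : (S : Subset k) {i j : Fin k} (i∈ : i ∈ S) (j∈ : j ∈ S) → i Fin.< j → index S i∈ Fin.< index S j∈
index-<-mono S i∈ j∈ i<j with Finₚ.<-cmp (index S i∈) (index S j∈)
... | tri< lt _ _ = lt
... | tri≈ _ eq _ = contradiction (index-injective S i∈ j∈ eq) (Finₚ.<⇒≢ i<j)
... | tri> _ _ gt = contradiction (subst₂ Fin._<_ (enum-index S j∈) (enum-index S i∈) (enum-<-mono S gt)) (Finₚ.<-asym i<j)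

inject : (A : Subset a) (B : Subset b) → ∣ A ∣ ≤ ∣ B ∣ → ∀ {i} → i ∈ A → Fin b
inject A B ∣A∣≤∣B∣ i∈ = enum B (Fin.inject≤ (index A i∈) ∣A∣≤∣B∣)

inject-∈ : (A : Subset a) (B : Subset b) (∣A∣≤∣B∣ : ∣ A ∣ ≤ ∣ B ∣) {i : Fin a} (i∈ : i ∈ A) →
           inject A B ∣A∣≤∣B∣ i∈ ∈ B
inject-∈ A B ∣A∣≤∣B∣ i∈ = enum-∈ B _

inject-injective : (A : Subset a) (B : Subset b) (∣A∣≤∣B∣ : ∣ A ∣ ≤ ∣ B ∣) {i j : Fin a} (i∈ : i ∈ A) (j∈ : j ∈ A) →
                   inject A B ∣A∣≤∣B∣ i∈ ≡ inject A B ∣A∣≤∣B∣ j∈ → i ≡ j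
inject-injective A B ∣A∣≤∣B∣ i∈ j∈ eq =
  index-injective A i∈ j∈ (Finₚ.inject≤-injective ∣A∣≤∣B∣ ∣A∣≤∣B∣ _ _ (enum-injective B eq))

∣p∣≤∣q∣-byInjection : (p : Subset a) (q : Subset b) (f : ∀ {i} → i ∈ p → Fin b) →
                      (∀ {i} (i∈ : i ∈ p) → f i∈ ∈ q) →
                      (∀ {i j} (i∈ : i ∈ p) (j∈ : j ∈ p) → f i∈ ≡ f j∈ → i ≡ j) →
                      ∣ p ∣ ≤ ∣ q ∣
∣p∣≤∣q∣-byInjection p q f f∈q f-inj = Finₚ.injective⇒≤ {f = g} g-inj
  where
  g : Fin ∣ p ∣ → Fin ∣ q ∣
  g j = index q (f∈q (enum-∈ p j))
  g-inj : Injective _≡_ _≡_ g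
  g-inj eq = enum-injective p (f-inj _ _ (index-injective q (f∈q _) (f∈q _) eq))

∈-image⁺ : (f : Fin a → Fin b) (X : Subset a) {j : Fin a} → j ∈ X → f j ∈ image f X
∈-image⁺ {suc a} f (true  ∷ X) here       = x∈p∪q⁺ (inj₁ (x∈⁅x⁆ _))
∈-image⁺ {suc a} f (true  ∷ X) (there j∈) = x∈p∪q⁺ (inj₂ (∈-image⁺ (f ∘ Fin.suc) X j∈))
∈-image⁺ {suc a} f (false ∷ X) (there j∈) = ∈-image⁺ (f ∘ Fin.suc) X j∈

∈-image⁻ : (f : Fin a → Fin b) (X : Subset a) {i : Fin b} → i ∈ image f X → ∃[ j ] j ∈ X × f j ≡ i
∈-image⁻ {zero}  f []          i∈ = contradiction i∈ ∉⊥
∈-image⁻ {suc a} f (true  ∷ X) i∈ with x∈p∪q⁻ ⁅ f Fin.zero ⁆ _ i∈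
... | inj₁ i∈⁅f0⁆ = Fin.zero , here , sym (x∈⁅y⁆⇒x≡y _ i∈⁅f0⁆)
... | inj₂ i∈img with ∈-image⁻ (f ∘ Fin.suc) X i∈img
...   | j , j∈ , eq = Fin.suc j , there j∈ , eq
∈-image⁻ {suc a} f (false ∷ X) i∈ with ∈-image⁻ (f ∘ Fin.suc) X i∈
... | j , j∈ , eq = Fin.suc j , there j∈ , eq

image-⊆ : (f : Fin a → Fin b) (X : Subset a) (Y : Subset b) → (∀ {j} → j ∈ X → f j ∈ Y) → image f X ⊆ Y
image-⊆ f X Y f∈Y i∈ with ∈-image⁻ f X i∈
... | j , j∈ , refl = f∈Y j∈

image-∪ : (f : Fin a → Fin b) (X Y : Subset a) → image f (X ∪ Y) ≡ image f X ∪ image f Y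
image-∪ f X Y = ⊆-antisym
  (image-⊆ f (X ∪ Y) _ λ j∈ → [ (λ j∈X → x∈p∪q⁺ (inj₁ (∈-image⁺ f X j∈X))) ,
                                (λ j∈Y → x∈p∪q⁺ (inj₂ (∈-image⁺ f Y j∈Y))) ]′ (x∈p∪q⁻ X Y j∈))
  (λ i∈ → [ image-⊆ f X _ (λ j∈ → ∈-image⁺ f (X ∪ Y) (x∈p∪q⁺ (inj₁ j∈))) ,
            image-⊆ f Y _ (λ j∈ → ∈-image⁺ f (X ∪ Y) (x∈p∪q⁺ (inj₂ j∈))) ]′ (x∈p∪q⁻ (image f X) _ i∈))

image-⁅⁆ : (f : Fin a → Fin b) (x : Fin a) → image f ⁅ x ⁆ ≡ ⁅ f x ⁆
image-⁅⁆ f x = ⊆-antisym (image-⊆ f ⁅ x ⁆ _ λ y∈ → subst (λ y → f y ∈ ⁅ f x ⁆) (sym (x∈⁅y⁆⇒x≡y _ y∈)) (x∈⁅x⁆ _))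
                         (λ y∈ → subst (_∈ image f ⁅ x ⁆) (sym (x∈⁅y⁆⇒x≡y _ y∈)) (∈-image⁺ f ⁅ x ⁆ (x∈⁅x⁆ x)))

∈-image-injective : (f : Fin a → Fin b) → Injective _≡_ _≡_ f → (X : Subset a) {j : Fin a} → f j ∈ image f X → j ∈ X
∈-image-injective f f-inj X fj∈ with ∈-image⁻ f X fj∈
... | i , i∈ , eq = subst (_∈ X) (f-inj eq) i∈

∣image∣≤ : (f : Fin a → Fin b) (X : Subset a) → ∣ image f X ∣ ≤ ∣ X ∣
∣image∣≤ f X = ∣p∣≤∣q∣-byInjection (image f X) X (proj₁ ∘ ∈-image⁻ f X) (proj₁ ∘ proj₂ ∘ ∈-image⁻ f X)
  λ i∈ j∈ eq → trans (sym (proj₂ (proj₂ (∈-image⁻ f X i∈)))) (trans (cong f eq) (proj₂ (proj₂ (∈-image⁻ f X j∈))))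

-- Matroid rank functions

module MatroidRank {E : ℕ} {r : Subset E → ℕ} (isMatroid : IsMatroidRank r) where
  open IsMatroidRank isMatroid

  mono : ∀ {X Y} → X ⊆ Y → r X ≤ r Y
  mono = monotone _ _

  r⊥≡0 : r ⊥ ≡ 0
  r⊥≡0 = ℕₚ.n≤0⇒n≡0 (ℕₚ.≤-trans (bounded ⊥) (ℕₚ.≤-reflexive (∣⊥∣≡0 E)))

  r-∪-≤ : ∀ X Y → r (X ∪ Y) ≤ r X + r Y
  r-∪-≤ X Y = ℕₚ.≤-trans (ℕₚ.m≤m+n _ _) (submodular X Y)

  r-∪⁅e⁆≤ : ∀ X e → r (X ∪ ⁅ e ⁆) ≤ suc (r X)
  r-∪⁅e⁆≤ X e = ℕₚ.≤-trans (r-∪-≤ X ⁅ e ⁆) (begin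
    r X + r ⁅ e ⁆ ≤⟨ ℕₚ.+-monoʳ-≤ (r X) (bounded ⁅ e ⁆) ⟩
    r X + ∣ ⁅ e ⁆ ∣ ≡⟨ cong (r X +_) (∣⁅x⁆∣≡1 e) ⟩
    r X + 1 ≡⟨ ℕₚ.+-comm (r X) 1 ⟩
    suc (r X) ∎)
    where open ℕₚ.≤-Reasoning

  r-≤-suc-r[X-x] : ∀ {X x} → x ∈ X → r X ≤ suc (r (X - x))
  r-≤-suc-r[X-x] {X} {x} x∈X = subst (λ Y → r Y ≤ suc (r (X - x))) (p-x∪⁅x⁆≡p x∈X) (r-∪⁅e⁆≤ (X - x) x)

  r[X-x]≤r : ∀ X x → r (X - x) ≤ r X
  r[X-x]≤r X x = mono x∈p-y⇒x∈p

  Spans : Subset E → Fin E → Set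
  Spans Z f = r (Z ∪ ⁅ f ⁆) ≡ r Z

  ∈⇒spans : ∀ {Z f} → f ∈ Z → Spans Z f
  ∈⇒spans {Z} f∈Z = cong r (⊆-antisym (∪-least ⊆-refl λ g∈ → subst (_∈ Z) (sym (x∈⁅y⁆⇒x≡y _ g∈)) f∈Z) (p⊆p∪q _))

  spans-⊆ : ∀ {Y Z e} → Y ⊆ Z → Spans Y e → Spans Z e
  spans-⊆ {Y} {Z} {e} Y⊆Z Y-spans = ℕₚ.≤-antisym (ℕₚ.+-cancelʳ-≤ (r Y) _ _ (begin
    r (Z ∪ ⁅ e ⁆) + r Y                         ≤⟨ ℕₚ.+-mono-≤ (ℕₚ.≤-reflexive (cong r Z∪Y∪e≡Z∪e)) (mono Y⊆Z∩[Y∪e]) ⟩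
    r (Z ∪ (Y ∪ ⁅ e ⁆)) + r (Z ∩ (Y ∪ ⁅ e ⁆))   ≤⟨ submodular Z (Y ∪ ⁅ e ⁆) ⟩
    r Z + r (Y ∪ ⁅ e ⁆)                         ≡⟨ cong (r Z +_) Y-spans ⟩
    r Z + r Y ∎)) (mono (p⊆p∪q _))
    where
    open ℕₚ.≤-Reasoning
    Z∪Y∪e≡Z∪e : Z ∪ ⁅ e ⁆ ≡ Z ∪ (Y ∪ ⁅ e ⁆)
    Z∪Y∪e≡Z∪e = ⊆-antisym (∪-mono ⊆-refl (q⊆p∪q _ _)) (∪-least (p⊆p∪q _) (∪-mono Y⊆Z ⊆-refl))
    Y⊆Z∩[Y∪e] : Y ⊆ Z ∩ (Y ∪ ⁅ e ⁆)
    Y⊆Z∩[Y∪e] y∈ = x∈p∩q⁺ (Y⊆Z y∈ , p⊆p∪q _ y∈)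

  spansAll⇒r≤ : ∀ Z Y → (∀ {f} → f ∈ Y → Spans Z f) → r Y ≤ r Z
  spansAll⇒r≤ Z Y Z-spans = ℕₚ.≤-trans (mono (q⊆p∪q Z Y)) (ℕₚ.≤-reflexive (r[Z∪Y]≡r Y Z-spans))
    where
    r[Z∪Y]≡r : ∀ Y → (∀ {f} → f ∈ Y → Spans Z f) → r (Z ∪ Y) ≡ r Z
    r[Z∪Y]≡r = removal-induction _ (λ _ → cong r (∪-identityʳ Z)) λ {Y} {y} y∈Y ih Z-spans → begin
      r (Z ∪ Y)                     ≡⟨ cong (λ V → r (Z ∪ V)) (sym (p-x∪⁅x⁆≡p y∈Y)) ⟩
      r (Z ∪ ((Y - y) ∪ ⁅ y ⁆))     ≡⟨ cong r (sym (∪-assoc Z (Y - y) ⁅ y ⁆)) ⟩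
      r ((Z ∪ (Y - y)) ∪ ⁅ y ⁆)     ≡⟨ spans-⊆ (p⊆p∪q _) (Z-spans y∈Y) ⟩
      r (Z ∪ (Y - y))               ≡⟨ ih (Z-spans ∘ x∈p-y⇒x∈p) ⟩
      r Z ∎
      where open ≡-Reasoning

  diminishingReturns : ∀ {A A′} B → A ⊆ A′ → r A + r (A′ ∪ B) ≤ r A′ + r (A ∪ B)
  diminishingReturns {A} {A′} B A⊆A′ = begin
    r A + r (A′ ∪ B)                     ≡⟨ ℕₚ.+-comm (r A) _ ⟩
    r (A′ ∪ B) + r A                     ≤⟨ ℕₚ.+-mono-≤ (ℕₚ.≤-reflexive (cong r A′∪B≡A′∪A∪B)) (mono A⊆A′∩[A∪B]) ⟩
    r (A′ ∪ (A ∪ B)) + r (A′ ∩ (A ∪ B))  ≤⟨ submodular A′ (A ∪ B) ⟩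
    r A′ + r (A ∪ B) ∎
    where
    open ℕₚ.≤-Reasoning
    A′∪B≡A′∪A∪B : A′ ∪ B ≡ A′ ∪ (A ∪ B)
    A′∪B≡A′∪A∪B = ⊆-antisym (∪-mono ⊆-refl (q⊆p∪q _ _)) (∪-least (p⊆p∪q _) (∪-mono A⊆A′ ⊆-refl))
    A⊆A′∩[A∪B] : A ⊆ A′ ∩ (A ∪ B)
    A⊆A′∩[A∪B] x∈ = x∈p∩q⁺ (A⊆A′ x∈ , p⊆p∪q _ x∈)

  -- r A + r B - r (A ∪ B) is the local connectivity of A and B.
  localConnectivity-mono : ∀ {A A′ B B′} → A ⊆ A′ → B ⊆ B′ →
                           r A + r B + r (A′ ∪ B′) ≤ r A′ + r B′ + r (A ∪ B)
  localConnectivity-mono {A} {A′} {B} {B′} A⊆A′ B⊆B′ = ℕₚ.+-cancelʳ-≤ (r (A′ ∪ B)) _ _ (begin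
    r A + r B + r (A′ ∪ B′) + r (A′ ∪ B)      ≡⟨ regroup (r A) (r B) (r (A′ ∪ B′)) (r (A′ ∪ B)) ⟩
    (r A + r (A′ ∪ B)) + (r B + r (A′ ∪ B′))  ≤⟨ ℕₚ.+-mono-≤ (diminishingReturns B A⊆A′) shiftB ⟩
    (r A′ + r (A ∪ B)) + (r B′ + r (A′ ∪ B))  ≡⟨ regroup′ (r A′) (r (A ∪ B)) (r B′) (r (A′ ∪ B)) ⟩
    r A′ + r B′ + r (A ∪ B) + r (A′ ∪ B) ∎)
    where
    open ℕₚ.≤-Reasoning
    open +-*-Solver
    regroup : ∀ a b c e → a + b + c + e ≡ (a + e) + (b + c)
    regroup = solve 4 (λ a b c e → a :+ b :+ c :+ e := (a :+ e) :+ (b :+ c)) refl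
    regroup′ : ∀ a b c e → (a + b) + (c + e) ≡ a + c + b + e
    regroup′ = solve 4 (λ a b c e → (a :+ b) :+ (c :+ e) := a :+ c :+ b :+ e) refl
    shiftB : r B + r (A′ ∪ B′) ≤ r B′ + r (A′ ∪ B)
    shiftB = subst₂ (λ X Y → r B + r X ≤ r B′ + r Y) (∪-comm B′ A′) (∪-comm B A′) (diminishingReturns A′ B⊆B′)

  SmallSplit : ℕ → Subset E → Set
  SmallSplit c X = r X < r ⊤ × r (∁ X) < r ⊤ × r X + r (∁ X) ≤ r ⊤ + c

  smallSplit⇒verticalSeparation : ∀ {c X} → SmallSplit c X → ∃[ k′ ] 1 ≤ k′ × k′ < c + 2 × VerticalSeparation r k′ X
  smallSplit⇒verticalSeparation {c} {X} (rX<r⊤ , r∁X<r⊤ , sum≤) = suc s , s≤s z≤n , s<c+2 , sep₁ , sep₂ , sep₃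
    where
    r⊤≤sum : r ⊤ ≤ r X + r (∁ X)
    r⊤≤sum = ℕₚ.≤-trans (ℕₚ.≤-reflexive (cong r (sym (p∪∁p≡⊤ X)))) (r-∪-≤ X (∁ X))
    s : ℕ
    s = proj₁ (ℕₚ.m≤n⇒∃[o]m+o≡n r⊤≤sum)
    r⊤+s≡sum : r ⊤ + s ≡ r X + r (∁ X)
    r⊤+s≡sum = proj₂ (ℕₚ.m≤n⇒∃[o]m+o≡n r⊤≤sum)
    s<c+2 : suc s < c + 2
    s<c+2 = ℕₚ.≤-trans (s≤s (s≤s (ℕₚ.+-cancelˡ-≤ (r ⊤) _ _ (ℕₚ.≤-trans (ℕₚ.≤-reflexive r⊤+s≡sum) sum≤))))
                      (ℕₚ.≤-reflexive (ℕₚ.+-comm 2 c))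
    sep₁ : suc s ≤ r X
    sep₁ = ℕₚ.+-cancelˡ-≤ (r ⊤) _ _ (begin
      r ⊤ + suc s          ≡⟨ ℕₚ.+-suc (r ⊤) s ⟩
      suc (r ⊤ + s)        ≡⟨ cong suc r⊤+s≡sum ⟩
      suc (r X + r (∁ X))  ≡⟨ sym (ℕₚ.+-suc (r X) _) ⟩
      r X + suc (r (∁ X))  ≤⟨ ℕₚ.+-monoʳ-≤ (r X) r∁X<r⊤ ⟩
      r X + r ⊤            ≡⟨ ℕₚ.+-comm (r X) _ ⟩
      r ⊤ + r X ∎)
      where open ℕₚ.≤-Reasoning
    sep₂ : suc s ≤ r (∁ X)
    sep₂ = ℕₚ.+-cancelˡ-≤ (r ⊤) _ _ (begin
      r ⊤ + suc s          ≡⟨ ℕₚ.+-suc (r ⊤) s ⟩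
      suc (r ⊤ + s)        ≡⟨ cong suc r⊤+s≡sum ⟩
      suc (r X) + r (∁ X)  ≤⟨ ℕₚ.+-monoˡ-≤ (r (∁ X)) rX<r⊤ ⟩
      r ⊤ + r (∁ X) ∎)
      where open ℕₚ.≤-Reasoning
    sep₃ : r X + r (∁ X) + 1 ≤ r ⊤ + suc s
    sep₃ = ℕₚ.≤-reflexive (trans (ℕₚ.+-comm _ 1) (trans (cong suc (sym r⊤+s≡sum)) (sym (ℕₚ.+-suc (r ⊤) s))))

  verticallyConnected⇒¬smallSplit : ∀ {c X} → VerticallyConnected r (c + 2) → ¬ SmallSplit c X
  verticallyConnected⇒¬smallSplit {X = X} (_ , noSeparation) split =
    let k′ , 1≤k′ , k′<c+2 , separation = smallSplit⇒verticalSeparation split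
    in noSeparation k′ X 1≤k′ k′<c+2 separation

  Indep : Subset E → Set
  Indep X = r X ≡ ∣ X ∣

  indep-⊆ : ∀ {X Y} → X ⊆ Y → Indep Y → Indep X
  indep-⊆ {X} {Y} X⊆Y Y-indep = ℕₚ.≤-antisym (bounded X) (ℕₚ.+-cancelʳ-≤ ∣ Y ∩ ∁ X ∣ _ _ (begin
    ∣ X ∣ + ∣ Y ∩ ∁ X ∣          ≡⟨ cong (λ Z → ∣ Z ∣ + ∣ Y ∩ ∁ X ∣) (sym Y∩X≡X) ⟩
    ∣ Y ∩ X ∣ + ∣ Y ∩ ∁ X ∣      ≡⟨ sym (∣p∣≡∣p∩q∣+∣p∩∁q∣ Y X) ⟩
    ∣ Y ∣                        ≡⟨ sym Y-indep ⟩
    r Y                          ≤⟨ mono Y⊆X∪[Y∩∁X] ⟩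
    r (X ∪ (Y ∩ ∁ X))            ≤⟨ r-∪-≤ X (Y ∩ ∁ X) ⟩
    r X + r (Y ∩ ∁ X)            ≤⟨ ℕₚ.+-monoʳ-≤ (r X) (bounded (Y ∩ ∁ X)) ⟩
    r X + ∣ Y ∩ ∁ X ∣ ∎))
    where
    open ℕₚ.≤-Reasoning
    Y∩X≡X : Y ∩ X ≡ X
    Y∩X≡X = ⊆-antisym (p∩q⊆q Y X) (λ x∈ → x∈p∩q⁺ (X⊆Y x∈ , x∈))
    Y⊆X∪[Y∩∁X] : Y ⊆ X ∪ (Y ∩ ∁ X)
    Y⊆X∪[Y∩∁X] {y} y∈ with y ∈? X
    ... | yes y∈X = p⊆p∪q _ y∈X
    ... | no y∉X  = q⊆p∪q _ _ (x∈p∩q⁺ (y∈ , x∉p⇒x∈∁p y∉X))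

  AllColoops : Subset E → Set
  AllColoops X = ∀ {f} → f ∈ X → r (X - f) < r X

  allColoops-minus : ∀ {X x} → x ∈ X → AllColoops X → AllColoops (X - x)
  allColoops-minus {X} {x} x∈X coloops {g} g∈ = ℕₚ.+-cancelˡ-≤ (r (X - g)) _ _ (begin
    r (X - g) + suc (r (X - x - g))                ≡⟨ ℕₚ.+-suc _ _ ⟩
    suc (r (X - g)) + r (X - x - g)                ≤⟨ ℕₚ.+-mono-≤ (coloops (x∈p-y⇒x∈p g∈)) (mono X-x-g⊆) ⟩
    r X + r ((X - x) ∩ (X - g))                    ≡⟨ cong (λ Y → r Y + r ((X - x) ∩ (X - g))) (sym X-x∪X-g≡X) ⟩
    r ((X - x) ∪ (X - g)) + r ((X - x) ∩ (X - g))  ≤⟨ submodular (X - x) (X - g) ⟩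
    r (X - x) + r (X - g)                          ≡⟨ ℕₚ.+-comm (r (X - x)) _ ⟩
    r (X - g) + r (X - x) ∎)
    where
    open ℕₚ.≤-Reasoning
    X-x-g⊆ : X - x - g ⊆ (X - x) ∩ (X - g)
    X-x-g⊆ y∈ = x∈p∩q⁺ (x∈p-y⇒x∈p y∈ , x∈p-y⇒x∈p (subst (_ ∈_) (p─x─y≡p─y─x X x g) y∈))
    X-x∪X-g≡X : (X - x) ∪ (X - g) ≡ X
    X-x∪X-g≡X = ⊆-antisym (∪-least x∈p-y⇒x∈p x∈p-y⇒x∈p) λ {y} y∈X → case y Finₚ.≟ x of λ where
      (yes refl) → q⊆p∪q _ _ (x∈p∧x≢y⇒x∈p-y y∈X (x∈p-y⇒x≢y g∈ ∘ sym))
      (no y≢x)   → p⊆p∪q _ (x∈p∧x≢y⇒x∈p-y y∈X y≢x)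

  allColoops⇒indep : ∀ X → AllColoops X → Indep X
  allColoops⇒indep = removal-induction _ (λ _ → trans r⊥≡0 (sym (∣⊥∣≡0 E))) λ {X} {x} x∈X ih coloops → begin
    r X                ≡⟨ ℕₚ.≤-antisym (r-≤-suc-r[X-x] x∈X) (coloops x∈X) ⟩
    suc (r (X - x))    ≡⟨ cong suc (ih (allColoops-minus x∈X coloops)) ⟩
    suc ∣ X - x ∣      ≡⟨ x∈p⇒suc∣p-x∣≡∣p∣ x∈X ⟩
    ∣ X ∣ ∎
    where open ≡-Reasoning

  dependent⇒redundant : ∀ X → r X < ∣ X ∣ → ∃[ f ] f ∈ X × r (X - f) ≡ r X
  dependent⇒redundant X r<∣X∣ with Finₚ.any? (λ f → (f ∈? X) ×-dec (r (X - f) ℕₚ.≟ r X))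
  ... | yes redundant = redundant
  ... | no ¬redundant = contradiction (allColoops⇒indep X coloop) (ℕₚ.<⇒≢ r<∣X∣)
    where
    coloop : AllColoops X
    coloop {f} f∈X = ℕₚ.≤∧≢⇒< (r[X-x]≤r X f) (λ eq → ¬redundant (f , f∈X , eq))

  minimalDependent : ∀ X → r X < ∣ X ∣ → ∃[ C ] C ⊆ X × r C < ∣ C ∣ × (∀ {f} → f ∈ C → Indep (C - f))
  minimalDependent = All.wfRec ⊂-wellFounded _ _ shrink
    where
    shrink : ∀ X → (∀ {Y} → Y ⊂ X → r Y < ∣ Y ∣ → ∃[ C ] C ⊆ Y × r C < ∣ C ∣ × (∀ {f} → f ∈ C → Indep (C - f))) →
             r X < ∣ X ∣ → ∃[ C ] C ⊆ X × r C < ∣ C ∣ × (∀ {f} → f ∈ C → Indep (C - f))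
    shrink X rec r<∣X∣ with Finₚ.any? (λ f → (f ∈? X) ×-dec (r (X - f) ℕₚ.<? ∣ X - f ∣))
    ... | yes (f , f∈X , dep) with rec (x∈p⇒p-x⊂p f∈X) dep
    ...   | C , C⊆ , C-dep , C-min = C , x∈p-y⇒x∈p ∘ C⊆ , C-dep , C-min
    shrink X rec r<∣X∣ | no ¬dep = X , ⊆-refl , r<∣X∣ , λ {f} f∈X →
      ℕₚ.≤-antisym (bounded (X - f)) (ℕₚ.≮⇒≥ (λ lt → ¬dep (f , f∈X , lt)))

module GraphProperties (G : Graph) where

  end₁ end₂ : Fin (m G) → Fin (n G)
  end₁ e = proj₁ (ends G e)
  end₂ e = proj₂ (ends G e)

  Touches : Fin (m G) → Fin (n G) → Set
  Touches e x = end₁ e ≡ x ⊎ end₂ e ≡ x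

  touches? : ∀ e x → Dec (Touches e x)
  touches? e x = (end₁ e Finₚ.≟ x) ⊎-dec (end₂ e Finₚ.≟ x)

  ∈-incident⁺ : ∀ {x e} → Touches e x → e ∈ incident G x
  ∈-incident⁺ {x} = ∈-subsetOf⁺ (λ e → touches? e x)

  ∈-incident⁻ : ∀ {x e} → e ∈ incident G x → Touches e x
  ∈-incident⁻ {x} = ∈-subsetOf⁻ (λ e → touches? e x)

  end₁≢end₂ : ∀ e → end₁ e ≢ end₂ e
  end₁≢end₂ e = Finₚ.<⇒≢ (ordered G e)

  joins-self : ∀ e → Joins G e (end₁ e) (end₂ e)
  joins-self e = inj₁ refl

  joins-sym : ∀ {e u v} → Joins G e u v → Joins G e v u
  joins-sym (inj₁ eq) = inj₂ eq
  joins-sym (inj₂ eq) = inj₁ eq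

  joins-ends : ∀ {e u v} → Joins G e u v → (end₁ e ≡ u × end₂ e ≡ v) ⊎ (end₁ e ≡ v × end₂ e ≡ u)
  joins-ends (inj₁ refl) = inj₁ (refl , refl)
  joins-ends (inj₂ refl) = inj₂ (refl , refl)

  joins-≢ : ∀ {e u v} → Joins G e u v → u ≢ v
  joins-≢ {e} (inj₁ refl) = end₁≢end₂ e
  joins-≢ {e} (inj₂ refl) = end₁≢end₂ e ∘ sym

  joins⇒touches : ∀ {e u v} → Joins G e u v → Touches e u
  joins⇒touches (inj₁ refl) = inj₁ refl
  joins⇒touches (inj₂ refl) = inj₂ refl

  touches-joins : ∀ {e u v x} → Joins G e u v → Touches e x → x ≡ u ⊎ x ≡ v
  touches-joins (inj₁ refl) (inj₁ refl) = inj₁ refl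
  touches-joins (inj₁ refl) (inj₂ refl) = inj₂ refl
  touches-joins (inj₂ refl) (inj₁ refl) = inj₂ refl
  touches-joins (inj₂ refl) (inj₂ refl) = inj₁ refl

  joins-unique : ∀ {e f u v} → Joins G e u v → Joins G f u v → e ≡ f
  joins-unique (inj₁ eq) (inj₁ eq′) = simple G (trans eq (sym eq′))
  joins-unique (inj₂ eq) (inj₂ eq′) = simple G (trans eq (sym eq′))
  joins-unique {e} {f} (inj₁ refl) (inj₂ eq) =
    contradiction (subst₂ Fin._<_ (cong proj₁ eq) (cong proj₂ eq) (ordered G f)) (Finₚ.<-asym (ordered G e))
  joins-unique {e} {f} (inj₂ refl) (inj₁ eq) =
    contradiction (subst₂ Fin._<_ (cong proj₁ eq) (cong proj₂ eq) (ordered G f)) (Finₚ.<-asym (ordered G e))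

  joins-injective : ∀ {e u v v′} → Joins G e u v → Joins G e u v′ → v ≡ v′
  joins-injective {e} j j′ with joins-ends j | joins-ends j′
  ... | inj₁ (_ , refl) | inj₁ (_ , refl) = refl
  ... | inj₂ (refl , _) | inj₂ (refl , _) = refl
  ... | inj₁ (refl , _) | inj₂ (_ , eq)   = contradiction eq (end₁≢end₂ e ∘ sym)
  ... | inj₂ (_ , refl) | inj₁ (eq , _)   = contradiction eq (end₁≢end₂ e)

  joins? : ∀ e u v → Dec (Joins G e u v)
  joins? e u v = (ends G e ≟ (u , v)) ⊎-dec (ends G e ≟ (v , u))
    where
    _≟_ : (p q : Fin (n G) × Fin (n G)) → Dec (p ≡ q)
    _≟_ = ×ₚ.≡-dec Finₚ._≟_ Finₚ._≟_

  adj? : ∀ u v → Dec (Adj G u v)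
  adj? u v = Finₚ.any? (λ e → joins? e u v)

  other : ∀ {e x} → Touches e x → Fin (n G)
  other {e} (inj₁ _) = end₂ e
  other {e} (inj₂ _) = end₁ e

  other-joins : ∀ {e x} (t : Touches e x) → Joins G e x (other t)
  other-joins (inj₁ refl) = inj₁ refl
  other-joins (inj₂ refl) = inj₂ refl

  inClique? : ∀ W f → Dec (end₁ f ∈ W × end₂ f ∈ W)
  inClique? W f = (end₁ f ∈? W) ×-dec (end₂ f ∈? W)

  clique : Subset (n G) → Subset (m G)
  clique W = subsetOf (inClique? W)

  ∈-clique⁺ : ∀ {W f u v} → Joins G f u v → u ∈ W → v ∈ W → f ∈ clique W
  ∈-clique⁺ {W} (inj₁ refl) u∈ v∈ = ∈-subsetOf⁺ (inClique? W) (u∈ , v∈)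
  ∈-clique⁺ {W} (inj₂ refl) u∈ v∈ = ∈-subsetOf⁺ (inClique? W) (v∈ , u∈)

  ∈-clique⁻ : ∀ {W f u v} → f ∈ clique W → Joins G f u v → u ∈ W × v ∈ W
  ∈-clique⁻ {W} f∈ (inj₁ refl) = ∈-subsetOf⁻ (inClique? W) f∈
  ∈-clique⁻ {W} f∈ (inj₂ refl) = let u∈ , v∈ = ∈-subsetOf⁻ (inClique? W) f∈ in v∈ , u∈

  clique-mono : ∀ {W W′} → W ⊆ W′ → clique W ⊆ clique W′
  clique-mono W⊆W′ f∈ = let u∈ , v∈ = ∈-clique⁻ f∈ (joins-self _) in ∈-clique⁺ (joins-self _) (W⊆W′ u∈) (W⊆W′ v∈)

  clique-avoids : ∀ {W z f} → z ∉ W → f ∈ clique W → ¬ Touches f z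
  clique-avoids z∉W f∈ (inj₁ refl) = z∉W (proj₁ (∈-clique⁻ f∈ (joins-self _)))
  clique-avoids z∉W f∈ (inj₂ refl) = z∉W (proj₂ (∈-clique⁻ f∈ (joins-self _)))

  inBetween? : ∀ U D f → Dec ((end₁ f ∈ U × end₂ f ∈ D) ⊎ (end₁ f ∈ D × end₂ f ∈ U))
  inBetween? U D f = ((end₁ f ∈? U) ×-dec (end₂ f ∈? D)) ⊎-dec ((end₁ f ∈? D) ×-dec (end₂ f ∈? U))

  between : Subset (n G) → Subset (n G) → Subset (m G)
  between U D = subsetOf (inBetween? U D)

  ∈-between⁺ : ∀ {U D f u v} → Joins G f u v → u ∈ U → v ∈ D → f ∈ between U D
  ∈-between⁺ {U} {D} (inj₁ refl) u∈ v∈ = ∈-subsetOf⁺ (inBetween? U D) (inj₁ (u∈ , v∈))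
  ∈-between⁺ {U} {D} (inj₂ refl) u∈ v∈ = ∈-subsetOf⁺ (inBetween? U D) (inj₂ (v∈ , u∈))

  ∈-between⁻ : ∀ {U D f} → f ∈ between U D → ∃[ u ] ∃[ v ] Joins G f u v × u ∈ U × v ∈ D
  ∈-between⁻ {U} {D} {f} f∈ with ∈-subsetOf⁻ (inBetween? U D) f∈
  ... | inj₁ (u∈ , v∈) = end₁ f , end₂ f , inj₁ refl , u∈ , v∈
  ... | inj₂ (v∈ , u∈) = end₂ f , end₁ f , inj₂ refl , u∈ , v∈

  between-monoˡ : ∀ {U U′ D} → U ⊆ U′ → between U D ⊆ between U′ D
  between-monoˡ U⊆U′ f∈ = let _ , _ , j , u∈ , v∈ = ∈-between⁻ f∈ in ∈-between⁺ j (U⊆U′ u∈) v∈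

  between⁅x⁆⊆incident : ∀ {x D} → between ⁅ x ⁆ D ⊆ incident G x
  between⁅x⁆⊆incident f∈ with ∈-between⁻ f∈
  ... | u , v , j , u∈ , _ = ∈-incident⁺ (subst (Touches _) (x∈⁅y⁆⇒x≡y _ u∈) (joins⇒touches j))

  ∣between⁅x⁆D∣≤∣D∣ : ∀ x D → ∣ between ⁅ x ⁆ D ∣ ≤ ∣ D ∣
  ∣between⁅x⁆D∣≤∣D∣ x D = ∣p∣≤∣q∣-byInjection (between ⁅ x ⁆ D) D (λ f∈ → proj₁ (proj₂ (∈-between⁻ f∈)))
    (λ f∈ → proj₂ (proj₂ (proj₂ (proj₂ (∈-between⁻ f∈))))) injective
    where
    injective : ∀ {f g} (f∈ : f ∈ between ⁅ x ⁆ D) (g∈ : g ∈ between ⁅ x ⁆ D) →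
                proj₁ (proj₂ (∈-between⁻ f∈)) ≡ proj₁ (proj₂ (∈-between⁻ g∈)) → f ≡ g
    injective f∈ g∈ eq with ∈-between⁻ f∈ | ∈-between⁻ g∈
    ... | u , v , j , u∈ , _ | u′ , v′ , j′ , u′∈ , _
      rewrite x∈⁅y⁆⇒x≡y _ u∈ | x∈⁅y⁆⇒x≡y _ u′∈ | eq = joins-unique j j′

  touching? : (A : Subset (n G)) → ∀ e → Dec (end₁ e ∈ A ⊎ end₂ e ∈ A)
  touching? A e = (end₁ e ∈? A) ⊎-dec (end₂ e ∈? A)

  touching : Subset (n G) → Subset (m G)
  touching A = subsetOf (touching? A)

  ¬touching-ends : ∀ {A e w} → e ∉ touching A → Touches e w → w ∉ A
  ¬touching-ends {A} e∉ (inj₁ refl) w∈A = e∉ (∈-subsetOf⁺ (touching? A) (inj₁ w∈A))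
  ¬touching-ends {A} e∉ (inj₂ refl) w∈A = e∉ (∈-subsetOf⁺ (touching? A) (inj₂ w∈A))

  neighbours : Fin (n G) → Subset (n G)
  neighbours v = subsetOf (adj? v)

  ∣neighbours∣≡degree : ∀ v → ∣ neighbours v ∣ ≡ degree G v
  ∣neighbours∣≡degree v = ℕₚ.≤-antisym
    (∣p∣≤∣q∣-byInjection (neighbours v) (incident G v) (proj₁ ∘ adj)
      (λ w∈ → ∈-incident⁺ (joins⇒touches (proj₂ (adj w∈))))
      (λ w∈ w′∈ eq → joins-injective (proj₂ (adj w∈)) (subst (λ e → Joins G e v _) (sym eq) (proj₂ (adj w′∈)))))
    (∣p∣≤∣q∣-byInjection (incident G v) (neighbours v) (other ∘ ∈-incident⁻)
      (λ e∈ → ∈-subsetOf⁺ (adj? v) (_ , other-joins (∈-incident⁻ e∈)))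
      (λ e∈ f∈ eq → joins-unique (other-joins (∈-incident⁻ e∈))
                                 (subst (Joins G _ v) (sym eq) (other-joins (∈-incident⁻ f∈)))))
    where
    adj : ∀ {w} → w ∈ neighbours v → Adj G v w
    adj = ∈-subsetOf⁻ (adj? v)

complete-joins : (K : Graph) → IsComplete K → ∀ {u v} → u ≢ v → ∃[ e ] Joins K e u v
complete-joins K K-complete {u} {v} u≢v with Finₚ.<-cmp u v
... | tri< u<v _ _ = let e , eq = K-complete u v u<v in e , inj₁ eq
... | tri≈ _ u≡v _ = contradiction u≡v u≢v
... | tri> _ _ v<u = let e , eq = K-complete v u v<u in e , inj₂ eq

module Complete (K : Graph) (K-complete : IsComplete K) where
  open GraphProperties K public

  edge : ∀ {u v} → u ≢ v → Fin (m K)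
  edge u≢v = proj₁ (complete-joins K K-complete u≢v)

  edge-joins : ∀ {u v} (u≢v : u ≢ v) → Joins K (edge u≢v) u v
  edge-joins u≢v = proj₂ (complete-joins K K-complete u≢v)

  ∣D∣≤∣between⁅x⁆D∣ : ∀ {x D} → x ∉ D → ∣ D ∣ ≤ ∣ between ⁅ x ⁆ D ∣
  ∣D∣≤∣between⁅x⁆D∣ {x} {D} x∉D = ∣p∣≤∣q∣-byInjection D (between ⁅ x ⁆ D) (edge ∘ x≢)
    (λ y∈ → ∈-between⁺ (edge-joins (x≢ y∈)) (x∈⁅x⁆ x) y∈)
    (λ y∈ z∈ eq → joins-injective (edge-joins (x≢ y∈)) (subst (λ e → Joins K e x _) (sym eq) (edge-joins (x≢ z∈))))
    where
    x≢ : ∀ {y} → y ∈ D → x ≢ y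
    x≢ y∈ refl = x∉D y∈

  module Extension (H : Graph) (φ : Fin (n H) → Fin (n K)) (φ-injective : Injective _≡_ _≡_ φ) where
    private module H = GraphProperties H

    φ-≢ : ∀ e → φ (H.end₁ e) ≢ φ (H.end₂ e)
    φ-≢ e = H.end₁≢end₂ e ∘ φ-injective

    edgeMap : Fin (m H) → Fin (m K)
    edgeMap e = edge (φ-≢ e)

    embedding : Embedding H K
    embedding = record { vmap = φ ; vmap-inj = φ-injective ; emap = edgeMap ; emap-ok = edge-joins ∘ φ-≢ }

    edgeMap-joins : ∀ {e a b} → Joins H e a b → Joins K (edgeMap e) (φ a) (φ b)
    edgeMap-joins {e} (inj₁ refl) = edge-joins (φ-≢ e)
    edgeMap-joins {e} (inj₂ refl) = joins-sym (edge-joins (φ-≢ e))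

minDegree : (G : Graph) → Fin (n G) → (∀ v → 0 < degree G v) → ∃[ δ ] MinDegree G (suc δ)
minDegree G x 0<deg with argmin (degree G) x
... | v , min = attained (degree G v) refl (0<deg v)
  where
  attained : ∀ δ → degree G v ≡ δ → 0 < δ → ∃[ δ′ ] MinDegree G (suc δ′)
  attained (suc δ) deg≡ _ = δ , (λ w → subst (_≤ degree G w) deg≡ (min w)) , v , deg≡

module Reachability (G : Graph) (S : Subset (n G)) where
  open GraphProperties G

  Closed : Subset (n G) → Set
  Closed A = ∀ {a w} → a ∈ A → Adj G a w → w ∉ S → w ∈ A

  reach-snoc : ∀ {u a w} → Reach G S u a → Adj G a w → w ∉ S → Reach G S u w
  reach-snoc here              adj w∉S = step adj w∉S here
  reach-snoc (step adj′ w′∉S r) adj w∉S = step adj′ w′∉S (reach-snoc r adj w∉S)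

  frontier? : (A : Subset (n G)) → ∀ w → Dec (w ∉ S × ∃[ a ] a ∈ A × Adj G a w)
  frontier? A w = ¬? (w ∈? S) ×-dec Finₚ.any? (λ a → (a ∈? A) ×-dec adj? a w)

  grow : Subset (n G) → Subset (n G)
  grow A = A ∪ subsetOf (frontier? A)

  ReachableFrom : Fin (n G) → Subset (n G) → Set
  ReachableFrom u A = ∀ {w} → w ∈ A → Reach G S u w

  grow-reachable : ∀ {u A} → ReachableFrom u A → ReachableFrom u (grow A)
  grow-reachable {A = A} reach w∈ with x∈p∪q⁻ A _ w∈
  ... | inj₁ w∈A     = reach w∈A
  ... | inj₂ w∈front = let w∉S , _ , a∈A , adj = ∈-subsetOf⁻ (frontier? A) w∈front in reach-snoc (reach a∈A) adj w∉S

  closure : ∀ {u} A → ReachableFrom u A → ∃[ B ] A ⊆ B × ReachableFrom u B × Closed B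
  closure {u} = All.wfRec ⊃-wellFounded _ _ extend
    where
    extend : ∀ A → (∀ {B} → B ⊃ A → ReachableFrom u B → ∃[ C ] B ⊆ C × ReachableFrom u C × Closed C) →
             ReachableFrom u A → ∃[ B ] A ⊆ B × ReachableFrom u B × Closed B
    extend A rec reach with Finₚ.any? (λ w → (w ∈? grow A) ×-dec ¬? (w ∈? A))
    ... | yes new = let B , grow⊆B , reachB , closedB = rec (p⊆p∪q _ , new) (grow-reachable reach)
                    in B , grow⊆B ∘ p⊆p∪q _ , reachB , closedB
    ... | no ¬new = A , ⊆-refl , reach , closed
      where
      closed : Closed A
      closed {w = w} a∈A adj w∉S with w ∈? A
      ... | yes w∈A = w∈A
      ... | no w∉A  = contradiction (w , q⊆p∪q _ _ (∈-subsetOf⁺ (frontier? A) (w∉S , _ , a∈A , adj)) , w∉A) ¬new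

  reach-or-separated : ∀ u v → Reach G S u v ⊎ ∃[ A ] u ∈ A × v ∉ A × Closed A
  reach-or-separated u v with closure ⁅ u ⁆ (λ w∈ → subst (Reach G S u) (sym (x∈⁅y⁆⇒x≡y u w∈)) here)
  ... | A , ⁅u⁆⊆A , reach , closed with v ∈? A
  ...   | yes v∈A = inj₁ (reach v∈A)
  ...   | no v∉A  = inj₂ (A , ⁅u⁆⊆A (x∈⁅x⁆ u) , v∉A , closed)

  touching-ends : ∀ {A e w} → Closed A → e ∈ touching A → Touches e w → w ∈ A ⊎ w ∈ S
  touching-ends {A} {e} closed e∈ t with ∈-subsetOf⁻ (touching? A) e∈ | t
  ... | inj₁ end₁∈A | inj₁ refl = inj₁ end₁∈A
  ... | inj₂ end₂∈A | inj₂ refl = inj₁ end₂∈A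
  ... | inj₁ end₁∈A | inj₂ refl with end₂ e ∈? S
  ...   | yes end₂∈S = inj₂ end₂∈S
  ...   | no end₂∉S  = inj₁ (closed end₁∈A (e , joins-self e) end₂∉S)
  touching-ends {A} {e} closed e∈ t | inj₂ end₂∈A | inj₁ refl with end₁ e ∈? S
  ...   | yes end₁∈S = inj₂ end₁∈S
  ...   | no end₁∉S  = inj₁ (closed end₂∈A (e , joins-sym (joins-self e)) end₁∉S)

module EdgeInduced (H : Graph) (D : Subset (m H)) where
  open GraphProperties H

  isVertex? : ∀ w → Dec (∃[ f ] f ∈ D × Touches f w)
  isVertex? w = Finₚ.any? (λ f → (f ∈? D) ×-dec touches? f w)

  vertices : Subset (n H)
  vertices = subsetOf isVertex?

  ∈-vertices : ∀ {f w} → f ∈ D → Touches f w → w ∈ vertices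
  ∈-vertices f∈D t = ∈-subsetOf⁺ isVertex? (_ , f∈D , t)

  end₁∈ : ∀ j → end₁ (enum D j) ∈ vertices
  end₁∈ j = ∈-vertices (enum-∈ D j) (inj₁ refl)

  end₂∈ : ∀ j → end₂ (enum D j) ∈ vertices
  end₂∈ j = ∈-vertices (enum-∈ D j) (inj₂ refl)

  graph : Graph
  graph = record
    { n       = ∣ vertices ∣
    ; m       = ∣ D ∣
    ; ends    = λ j → index vertices (end₁∈ j) , index vertices (end₂∈ j)
    ; ordered = λ j → index-<-mono vertices (end₁∈ j) (end₂∈ j) (ordered H (enum D j))
    ; simple  = λ {i} {j} eq → enum-injective D (simple H (cong₂ _,_
                  (index-injective vertices (end₁∈ i) (end₁∈ j) (cong proj₁ eq))
                  (index-injective vertices (end₂∈ i) (end₂∈ j) (cong proj₂ eq))))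
    }

  private module D = GraphProperties graph

  inclusion : Embedding graph H
  inclusion = record
    { vmap     = enum vertices
    ; vmap-inj = enum-injective vertices
    ; emap     = enum D
    ; emap-ok  = λ j → inj₁ (sym (cong₂ _,_ (enum-index vertices (end₁∈ j)) (enum-index vertices (end₂∈ j))))
    }

  image-⊤ : image (enum D) ⊤ ≡ D
  image-⊤ = ⊆-antisym (image-⊆ (enum D) ⊤ D λ {j} _ → enum-∈ D j)
    λ f∈D → subst (_∈ image (enum D) ⊤) (enum-index D f∈D) (∈-image⁺ (enum D) ⊤ ∈⊤)

  image-⊤-j : ∀ j → image (enum D) (⊤ - j) ≡ D - enum D j
  image-⊤-j j = ⊆-antisym
    (image-⊆ (enum D) (⊤ - j) _ λ {i} i∈ → x∈p∧x≢y⇒x∈p-y (enum-∈ D i) (x∈p-y⇒x≢y i∈ ∘ enum-injective D))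
    λ {f} f∈ → subst (_∈ image (enum D) (⊤ - j)) (enum-index D (x∈p-y⇒x∈p f∈))
      (∈-image⁺ (enum D) (⊤ - j) (x∈p∧x≢y⇒x∈p-y ∈⊤ λ eq →
        x∈p-y⇒x≢y f∈ (trans (sym (enum-index D (x∈p-y⇒x∈p f∈))) (cong (enum D) eq))))

  touches-enum : ∀ {j v} → D.Touches j v → Touches (enum D j) (enum vertices v)
  touches-enum {j} (inj₁ refl) = inj₁ (sym (enum-index vertices (end₁∈ j)))
  touches-enum {j} (inj₂ refl) = inj₂ (sym (enum-index vertices (end₂∈ j)))

  0<degree : ∀ v → 0 < degree graph v
  0<degree v with ∈-subsetOf⁻ isVertex? (enum-∈ vertices v)
  ... | f , f∈D , t = x∈p⇒0<∣p∣ (D.∈-incident⁺ (touches-index t))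
    where
    touches-index : Touches f (enum vertices v) → D.Touches (index D f∈D) v
    touches-index (inj₁ eq) = inj₁ (index-enum vertices (end₁∈ _) (sym (trans (cong end₁ (enum-index D f∈D)) eq)))
    touches-index (inj₂ eq) = inj₂ (index-enum vertices (end₂∈ _) (sym (trans (cong end₂ (enum-index D f∈D)) eq)))

  degree≤ : ∀ v → degree graph v ≤ ∣ D ∩ incident H (enum vertices v) ∣
  degree≤ v = ∣p∣≤∣q∣-byInjection (incident graph v) _ (λ {j} _ → enum D j)
    (λ {j} j∈ → x∈p∩q⁺ (enum-∈ D j , ∈-incident⁺ (touches-enum (D.∈-incident⁻ j∈))))
    (λ _ _ → enum-injective D)

-- Dimensionality: edges at a vertex of low degree are coloops

CircuitDegreeBound : GraphMatroidFamily → ℕ → Set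
CircuitDegreeBound M d = ∀ C d′ → Circuit M C → MinDegree C (suc d′) → d ≤ d′

module LowDegree (M : GraphMatroidFamily) {d : ℕ} (dim-min : CircuitDegreeBound M d)
                 (H : Graph) where
  open GraphProperties H
  open MatroidRank (matroid M H)

  edgeInduced-circuit : ∀ {C} → rank M H C < ∣ C ∣ → (∀ {g} → g ∈ C → Indep (C - g)) →
                        Circuit M (EdgeInduced.graph H C)
  edgeInduced-circuit {C} C-dep C-min = notIndependent , deletionIndependent
    where
    open EdgeInduced H C
    rank≡ : ∀ Y → rank M graph Y ≡ rank M H (image (enum C) Y)
    rank≡ = compat M graph H inclusion
    notIndependent : ¬ Independent M graph
    notIndependent indep = ℕₚ.<⇒≢ C-dep (trans (cong (rank M H) (sym image-⊤)) (trans (sym (rank≡ ⊤)) indep))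
    deletionIndependent : ∀ j → rank M graph (⊤ - j) ≡ ∣ ⊤ {∣ C ∣} - j ∣
    deletionIndependent j = begin
      rank M graph (⊤ - j)              ≡⟨ trans (rank≡ (⊤ - j)) (cong (rank M H) (image-⊤-j j)) ⟩
      rank M H (C - enum C j)           ≡⟨ C-min (enum-∈ C j) ⟩
      ∣ C - enum C j ∣                  ≡⟨ ℕₚ.suc-injective (trans (x∈p⇒suc∣p-x∣≡∣p∣ (enum-∈ C j))
                                             (sym (trans (x∈p⇒suc∣p-x∣≡∣p∣ {p = ⊤ {∣ C ∣}} {x = j} ∈⊤)
                                                         (∣⊤∣≡n ∣ C ∣)))) ⟩
      ∣ ⊤ {∣ C ∣} - j ∣ ∎
      where open ≡-Reasoning

  d<degree-circuit : ∀ {C f x} → rank M H C < ∣ C ∣ → (∀ {g} → g ∈ C → Indep (C - g)) →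
                     f ∈ C → Touches f x → d < ∣ C ∩ incident H x ∣
  d<degree-circuit {C} {f} {x} C-dep C-min f∈C t = begin-strict
    d                                              <⟨ s≤s (dim-min graph δ (edgeInduced-circuit C-dep C-min) δ-min) ⟩
    suc δ                                          ≤⟨ proj₁ δ-min x′ ⟩
    degree graph x′                                ≤⟨ degree≤ x′ ⟩
    ∣ C ∩ incident H (enum vertices x′) ∣           ≡⟨ cong (λ y → ∣ C ∩ incident H y ∣) (enum-index vertices _) ⟩
    ∣ C ∩ incident H x ∣ ∎
    where
    open EdgeInduced H C
    open ℕₚ.≤-Reasoning
    x′ : Fin ∣ vertices ∣
    x′ = index vertices (∈-vertices f∈C t)
    δ : ℕ
    δ = proj₁ (minDegree graph x′ 0<degree)
    δ-min : MinDegree graph (suc δ)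
    δ-min = proj₂ (minDegree graph x′ 0<degree)

  LowDegreeAt : Subset (m H) → Fin (n H) → Set
  LowDegreeAt F x = ∣ F ∩ incident H x ∣ ≤ d

  -- A minimal dependent subset of F ∪ e must use e, so its degree at x exceeds d.
  indep-lowDegree⇒¬spans : ∀ F {e x} → Indep F → e ∉ F → Touches e x → LowDegreeAt (F ∪ ⁅ e ⁆) x → ¬ Spans F e
  indep-lowDegree⇒¬spans F {e} {x} F-indep e∉F t low spans with minimalDependent (F ∪ ⁅ e ⁆) F∪e-dep
    where
    F∪e-dep : rank M H (F ∪ ⁅ e ⁆) < ∣ F ∪ ⁅ e ⁆ ∣
    F∪e-dep = subst₂ _<_ (sym (trans spans F-indep)) (sym (x∉p⇒∣p∪⁅x⁆∣≡suc∣p∣ e∉F)) ℕₚ.≤-refl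
  ... | C , C⊆F∪e , C-dep , C-min =
    ℕₚ.≤⇒≯ (ℕₚ.≤-trans (p⊆q⇒∣p∣≤∣q∣ (∩-monoˡ C⊆F∪e)) low) (d<degree-circuit C-dep C-min e∈C t)
    where
    e∈C : e ∈ C
    e∈C with e ∈? C
    ... | yes e∈C = e∈C
    ... | no e∉C  = contradiction (indep-⊆ C⊆F F-indep) (ℕₚ.<⇒≢ C-dep)
      where
      C⊆F : C ⊆ F
      C⊆F g∈C = [ id , (λ g≡e → contradiction (subst (_∈ C) (x∈⁅y⁆⇒x≡y _ g≡e) g∈C) e∉C) ]′ (x∈p∪q⁻ F _ (C⊆F∪e g∈C))

  -- Deleting an edge that F spans keeps the hypotheses, so we may assume F independent.
  lowDegree⇒¬spans : ∀ F {e x} → e ∉ F → Touches e x → LowDegreeAt (F ∪ ⁅ e ⁆) x → ¬ Spans F e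
  lowDegree⇒¬spans = All.wfRec ⊂-wellFounded _ _ shrink
    where
    shrink : ∀ F → (∀ {F′} → F′ ⊂ F → ∀ {e x} → e ∉ F′ → Touches e x → LowDegreeAt (F′ ∪ ⁅ e ⁆) x → ¬ Spans F′ e) →
             ∀ {e x} → e ∉ F → Touches e x → LowDegreeAt (F ∪ ⁅ e ⁆) x → ¬ Spans F e
    shrink F rec {e} e∉F t low spans with rank M H F ℕₚ.<? ∣ F ∣
    ... | no ¬dep = indep-lowDegree⇒¬spans F (ℕₚ.≤-antisym (IsMatroidRank.bounded (matroid M H) F) (ℕₚ.≮⇒≥ ¬dep)) e∉F t low spans
    ... | yes dep with dependent⇒redundant F dep
    ...   | f , f∈F , r[F-f]≡r = rec (x∈p⇒p-x⊂p f∈F) (e∉F ∘ x∈p-y⇒x∈p) t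
              (ℕₚ.≤-trans (p⊆q⇒∣p∣≤∣q∣ (∩-monoˡ F-f∪e⊆F∪e)) low)
              (ℕₚ.≤-antisym (ℕₚ.≤-trans (mono F-f∪e⊆F∪e) (ℕₚ.≤-reflexive (trans spans (sym r[F-f]≡r))))
                            (mono (p⊆p∪q _)))
      where
      F-f∪e⊆F∪e : (F - f) ∪ ⁅ e ⁆ ⊆ F ∪ ⁅ e ⁆
      F-f∪e⊆F∪e = ∪-mono x∈p-y⇒x∈p ⊆-refl

  lowDegree⇒coloop : ∀ F {e x} → e ∉ F → Touches e x → LowDegreeAt (F ∪ ⁅ e ⁆) x → rank M H (F ∪ ⁅ e ⁆) ≡ suc (rank M H F)
  lowDegree⇒coloop F e∉F t low =
    ℕₚ.≤-antisym (r-∪⁅e⁆≤ F _) (ℕₚ.≤∧≢⇒< (mono (p⊆p∪q _)) (lowDegree⇒¬spans F e∉F t low ∘ sym))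

  avoidsVertex⇒r<r⊤ : 0 < d → ∀ F {e z} → e ∉ F → Touches e z → (∀ {f} → f ∈ F → ¬ Touches f z) →
                      rank M H F < rank M H ⊤
  avoidsVertex⇒r<r⊤ 0<d F {e} {z} e∉F t F-avoids-z = begin-strict
    rank M H F                 <⟨ ℕₚ.≤-reflexive (sym (lowDegree⇒coloop F e∉F t low)) ⟩
    rank M H (F ∪ ⁅ e ⁆)       ≤⟨ mono ⊆⊤ ⟩
    rank M H ⊤ ∎
    where
    open ℕₚ.≤-Reasoning
    ⊆⁅e⁆ : (F ∪ ⁅ e ⁆) ∩ incident H z ⊆ ⁅ e ⁆
    ⊆⁅e⁆ f∈ = let f∈F∪e , f∈inc = x∈p∩q⁻ _ _ f∈ in
      [ (λ f∈F → contradiction (∈-incident⁻ f∈inc) (F-avoids-z f∈F)) , id ]′ (x∈p∪q⁻ F _ f∈F∪e)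
    low : LowDegreeAt (F ∪ ⁅ e ⁆) z
    low = ℕₚ.≤-trans (p⊆q⇒∣p∣≤∣q∣ ⊆⁅e⁆) (ℕₚ.≤-trans (ℕₚ.≤-reflexive (∣⁅x⁆∣≡1 e)) 0<d)

  r-∪-lowDegreeStar : ∀ F {x} → (∀ {f} → f ∈ F → ¬ Touches f x) →
                      ∀ S → S ⊆ incident H x → ∣ S ∣ ≤ d → rank M H F + ∣ S ∣ ≤ rank M H (F ∪ S)
  r-∪-lowDegreeStar F {x} F-avoids-x = removal-induction _ (λ _ _ → base) λ {S} {y} y∈S ih S⊆inc ∣S∣≤d → begin
    rank M H F + ∣ S ∣                      ≡⟨ cong (rank M H F +_) (sym (x∈p⇒suc∣p-x∣≡∣p∣ y∈S)) ⟩
    rank M H F + suc ∣ S - y ∣              ≡⟨ ℕₚ.+-suc _ _ ⟩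
    suc (rank M H F + ∣ S - y ∣)            ≤⟨ s≤s (ih (S⊆inc ∘ x∈p-y⇒x∈p)
                                                        (ℕₚ.≤-trans (p⊆q⇒∣p∣≤∣q∣ (x∈p-y⇒x∈p {p = S} {y = y})) ∣S∣≤d)) ⟩
    suc (rank M H (F ∪ (S - y)))            ≡⟨ sym (lowDegree⇒coloop (F ∪ (S - y)) (y∉ S⊆inc y∈S) (∈-incident⁻ (S⊆inc y∈S))
                                                 (subst (λ Z → LowDegreeAt Z x) (sym (rebuild y∈S)) (low S⊆inc ∣S∣≤d))) ⟩
    rank M H ((F ∪ (S - y)) ∪ ⁅ y ⁆)        ≡⟨ cong (rank M H) (rebuild y∈S) ⟩
    rank M H (F ∪ S) ∎
    where
    open ℕₚ.≤-Reasoning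
    base : rank M H F + ∣ ⊥ {m H} ∣ ≤ rank M H (F ∪ ⊥)
    base = ℕₚ.≤-reflexive (trans (cong (rank M H F +_) (∣⊥∣≡0 (m H)))
                                  (trans (ℕₚ.+-identityʳ _) (cong (rank M H) (sym (∪-identityʳ F)))))
    rebuild : ∀ {S y} → y ∈ S → (F ∪ (S - y)) ∪ ⁅ y ⁆ ≡ F ∪ S
    rebuild {S} {y} y∈S = trans (∪-assoc F _ _) (cong (F ∪_) (p-x∪⁅x⁆≡p y∈S))
    y∉ : ∀ {S y} → S ⊆ incident H x → y ∈ S → y ∉ F ∪ (S - y)
    y∉ S⊆inc y∈S y∈ = [ (λ y∈F → F-avoids-x y∈F (∈-incident⁻ (S⊆inc y∈S))) ,
                        (λ y∈S-y → x∈p-y⇒x≢y y∈S-y refl) ]′ (x∈p∪q⁻ F _ y∈)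
    low : ∀ {S} → S ⊆ incident H x → ∣ S ∣ ≤ d → LowDegreeAt (F ∪ S) x
    low {S} S⊆inc ∣S∣≤d = ℕₚ.≤-trans (p⊆q⇒∣p∣≤∣q∣ F∪S∩inc⊆S) ∣S∣≤d
      where
      F∪S∩inc⊆S : (F ∪ S) ∩ incident H x ⊆ S
      F∪S∩inc⊆S g∈ with x∈p∩q⁻ _ _ g∈
      ... | g∈F∪S , g∈inc = [ (λ g∈F → contradiction (∈-incident⁻ g∈inc) (F-avoids-x g∈F)) , id ]′ (x∈p∪q⁻ F S g∈F∪S)

module CliqueLowerBound (M : GraphMatroidFamily) {d : ℕ} (dim-min : CircuitDegreeBound M d)
                        (K : Graph) (K-complete : IsComplete K) where
  open Complete K K-complete
  open LowDegree M dim-min K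
  open MatroidRank (matroid M K)

  r-∪-between≥ : ∀ F {D} → ∣ D ∣ ≤ d → ∀ U → (∀ {x} → x ∈ U → ∀ {f} → f ∈ F → ¬ Touches f x) →
                 (∀ {x} → x ∈ U → x ∉ D) →
                 rank M K F + ∣ U ∣ * ∣ D ∣ ≤ rank M K (F ∪ between U D)
  r-∪-between≥ F {D} ∣D∣≤d = removal-induction _ (λ _ _ → base) λ {U} {x} x∈U ih F-avoids-U U∩D≡∅ → begin
    rank M K F + ∣ U ∣ * ∣ D ∣
      ≡⟨ cong (λ s → rank M K F + s * ∣ D ∣) (sym (x∈p⇒suc∣p-x∣≡∣p∣ x∈U)) ⟩
    rank M K F + (∣ D ∣ + ∣ U - x ∣ * ∣ D ∣)
      ≡⟨ regroup (rank M K F) ∣ D ∣ (∣ U - x ∣ * ∣ D ∣) ⟩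
    rank M K F + ∣ U - x ∣ * ∣ D ∣ + ∣ D ∣
      ≤⟨ ℕₚ.+-mono-≤ (ih (F-avoids-U ∘ x∈p-y⇒x∈p) (U∩D≡∅ ∘ x∈p-y⇒x∈p)) (∣D∣≤∣between⁅x⁆D∣ (U∩D≡∅ x∈U)) ⟩
    rank M K (F ∪ between (U - x) D) + ∣ between ⁅ x ⁆ D ∣
      ≤⟨ r-∪-lowDegreeStar _ (avoids-x x∈U F-avoids-U U∩D≡∅) _ between⁅x⁆⊆incident
                            (ℕₚ.≤-trans (∣between⁅x⁆D∣≤∣D∣ x D) ∣D∣≤d) ⟩
    rank M K ((F ∪ between (U - x) D) ∪ between ⁅ x ⁆ D)
      ≤⟨ mono (∪-least (∪-mono ⊆-refl (between-monoˡ x∈p-y⇒x∈p))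
                       (q⊆p∪q _ _ ∘ between-monoˡ λ y∈ → subst (_∈ U) (sym (x∈⁅y⁆⇒x≡y _ y∈)) x∈U)) ⟩
    rank M K (F ∪ between U D) ∎
    where
    open ℕₚ.≤-Reasoning
    open +-*-Solver
    regroup : ∀ a b c → a + (b + c) ≡ a + c + b
    regroup = solve 3 (λ a b c → a :+ (b :+ c) := a :+ c :+ b) refl
    base : rank M K F + ∣ ⊥ {n K} ∣ * ∣ D ∣ ≤ rank M K (F ∪ between ⊥ D)
    base = ℕₚ.≤-trans (ℕₚ.≤-reflexive (trans (cong (λ s → rank M K F + s * ∣ D ∣) (∣⊥∣≡0 (n K))) (ℕₚ.+-identityʳ _)))
                      (mono (p⊆p∪q _))
    avoids-x : ∀ {U x} → x ∈ U → (∀ {x} → x ∈ U → ∀ {f} → f ∈ F → ¬ Touches f x) → (∀ {x} → x ∈ U → x ∉ D) →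
               ∀ {f} → f ∈ F ∪ between (U - x) D → ¬ Touches f x
    avoids-x {U} {x} x∈U F-avoids-U U∩D≡∅ f∈ t with x∈p∪q⁻ F _ f∈
    ... | inj₁ f∈F = F-avoids-U x∈U f∈F t
    ... | inj₂ f∈between with ∈-between⁻ f∈between
    ...   | u , v , j , u∈ , v∈ with touches-joins j t
    ...     | inj₁ refl = x∈p-y⇒x≢y u∈ refl
    ...     | inj₂ refl = U∩D≡∅ x∈U v∈

-- Threshold: a circuit of minimum degree d + 1 on t + 1 vertices

module ThresholdCircuit (M : GraphMatroidFamily) {d t : ℕ} (C₀ : Graph) (C₀-circuit : Circuit M C₀)
                        (C₀-minDegree : MinDegree C₀ (suc d)) (C₀-size : n C₀ ≡ suc t) where
  private module C = GraphProperties C₀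

  v₀ : Fin (n C₀)
  v₀ = proj₁ (proj₂ C₀-minDegree)

  deg-v₀ : degree C₀ v₀ ≡ suc d
  deg-v₀ = proj₂ (proj₂ C₀-minDegree)

  edge-at-v₀ : Nonempty (incident C₀ v₀)
  edge-at-v₀ = 0<∣p∣⇒Nonempty (incident C₀ v₀) (subst (0 <_) (sym deg-v₀) (s≤s z≤n))

  e₀ : Fin (m C₀)
  e₀ = proj₁ edge-at-v₀

  w₀ : Fin (n C₀)
  w₀ = C.other (C.∈-incident⁻ (proj₂ edge-at-v₀))

  e₀-joins : Joins C₀ e₀ v₀ w₀
  e₀-joins = C.other-joins (C.∈-incident⁻ (proj₂ edge-at-v₀))

  w₀∈neighbours : w₀ ∈ C.neighbours v₀
  w₀∈neighbours = ∈-subsetOf⁺ (C.adj? v₀) (e₀ , e₀-joins)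

  ∣neighbours∣≡1+d : ∣ C.neighbours v₀ ∣ ≡ suc d
  ∣neighbours∣≡1+d = trans (C.∣neighbours∣≡degree v₀) deg-v₀

  N₀ : Subset (n C₀)
  N₀ = C.neighbours v₀ - w₀

  ∣N₀∣≡d : ∣ N₀ ∣ ≡ d
  ∣N₀∣≡d = ℕₚ.suc-injective (trans (x∈p⇒suc∣p-x∣≡∣p∣ w₀∈neighbours) ∣neighbours∣≡1+d)

  v₀∉neighbours : v₀ ∉ C.neighbours v₀
  v₀∉neighbours v₀∈ = C.joins-≢ (proj₂ (∈-subsetOf⁻ (C.adj? v₀) v₀∈)) refl

  far : Subset (n C₀)
  far = ∁ (C.neighbours v₀ ∪ ⁅ v₀ ⁆)

  ∣far∣+2+d≡1+t : ∣ far ∣ + suc (suc d) ≡ suc t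
  ∣far∣+2+d≡1+t = begin
    ∣ far ∣ + suc (suc d)                         ≡⟨ cong (λ s → ∣ far ∣ + suc s) (sym ∣neighbours∣≡1+d) ⟩
    ∣ far ∣ + suc ∣ C.neighbours v₀ ∣              ≡⟨ cong (∣ far ∣ +_) (sym (x∉p⇒∣p∪⁅x⁆∣≡suc∣p∣ v₀∉neighbours)) ⟩
    ∣ far ∣ + ∣ C.neighbours v₀ ∪ ⁅ v₀ ⁆ ∣         ≡⟨ ℕₚ.+-comm ∣ far ∣ _ ⟩
    ∣ C.neighbours v₀ ∪ ⁅ v₀ ⁆ ∣ + ∣ far ∣         ≡⟨ ∣p∣+∣∁p∣≡n (C.neighbours v₀ ∪ ⁅ v₀ ⁆) ⟩
    n C₀                                          ≡⟨ C₀-size ⟩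
    suc t ∎
    where open ≡-Reasoning

  d<t : d < t
  d<t = ℕₚ.≤-pred (ℕₚ.≤-trans (ℕₚ.m≤n+m (suc (suc d)) ∣ far ∣) (ℕₚ.≤-reflexive ∣far∣+2+d≡1+t))

  e₀-spanned : rank M C₀ ⊤ ≡ rank M C₀ (⊤ - e₀)
  e₀-spanned = ℕₚ.≤-antisym (ℕₚ.≤-pred (begin-strict
    rank M C₀ ⊤                  <⟨ ℕₚ.≤∧≢⇒< (ℕₚ.≤-trans (IsMatroidRank.bounded (matroid M C₀) ⊤) (ℕₚ.≤-reflexive (∣⊤∣≡n (m C₀))))
                                              (proj₁ C₀-circuit) ⟩
    m C₀                         ≡⟨ sym (trans (x∈p⇒suc∣p-x∣≡∣p∣ {p = ⊤} {x = e₀} ∈⊤) (∣⊤∣≡n (m C₀))) ⟩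
    suc ∣ ⊤ {m C₀} - e₀ ∣          ≡⟨ cong suc (sym (proj₂ C₀-circuit e₀)) ⟩
    suc (rank M C₀ (⊤ - e₀)) ∎))
    (IsMatroidRank.monotone (matroid M C₀) _ _ x∈p-y⇒x∈p)
    where open ℕₚ.≤-Reasoning

  -- Embed C₀ into K with v₀ ↦ x, w₀ ↦ y, N₀ onto D and the remaining vertices into W; only e₀ lands outside
  -- clique W ∪ between ⁅ x ⁆ D, so the edge xy is spanned by that set.
  module Placement (K : Graph) (K-complete : IsComplete K) {W : Subset (n K)} {x y : Fin (n K)} {D : Subset (n K)}
                   (x∉W : x ∉ W) (y∈W : y ∈ W) (y∉D : y ∉ D) (D⊆W : D ⊆ W) (∣D∣≡d : ∣ D ∣ ≡ d)
                   (t≤∣W∣ : t ≤ ∣ W ∣) where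
    open Complete K K-complete
    open MatroidRank (matroid M K)

    W′ : Subset (n K)
    W′ = W ∩ ∁ (D ∪ ⁅ y ⁆)

    ∣far∣≤∣W′∣ : ∣ far ∣ ≤ ∣ W′ ∣
    ∣far∣≤∣W′∣ = ℕₚ.+-cancelʳ-≤ (suc (suc d)) _ _ (begin
      ∣ far ∣ + suc (suc d)                           ≡⟨ ∣far∣+2+d≡1+t ⟩
      suc t                                           ≤⟨ s≤s t≤∣W∣ ⟩
      suc ∣ W ∣                                       ≡⟨ cong suc (∣p∣≡∣p∩q∣+∣p∩∁q∣ W (D ∪ ⁅ y ⁆)) ⟩
      suc (∣ W ∩ (D ∪ ⁅ y ⁆) ∣ + ∣ W′ ∣)                ≤⟨ s≤s (ℕₚ.+-monoˡ-≤ ∣ W′ ∣ (∣p∩q∣≤∣q∣ W _)) ⟩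
      suc (∣ D ∪ ⁅ y ⁆ ∣ + ∣ W′ ∣)                      ≡⟨ cong (λ s → suc (s + ∣ W′ ∣))
                                                             (trans (x∉p⇒∣p∪⁅x⁆∣≡suc∣p∣ y∉D) (cong suc ∣D∣≡d)) ⟩
      suc (suc d + ∣ W′ ∣)                              ≡⟨ cong suc (ℕₚ.+-comm (suc d) ∣ W′ ∣) ⟩
      suc (∣ W′ ∣ + suc d)                              ≡⟨ sym (ℕₚ.+-suc ∣ W′ ∣ (suc d)) ⟩
      ∣ W′ ∣ + suc (suc d) ∎)
      where open ℕₚ.≤-Reasoning

    data Role (w : Fin (n C₀)) : Set where
      centre    : w ≡ v₀ → Role w
      target    : w ≡ w₀ → Role w
      neighbour : w ∈ N₀ → Role w
      remote    : w ∈ far → Role w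

    role : ∀ w → Role w
    role w with w Finₚ.≟ v₀ | w Finₚ.≟ w₀ | w ∈? C.neighbours v₀
    ... | yes w≡v₀ | _        | _        = centre w≡v₀
    ... | no _     | yes w≡w₀ | _        = target w≡w₀
    ... | no _     | no w≢w₀  | yes w∈Nv = neighbour (x∈p∧x≢y⇒x∈p-y w∈Nv w≢w₀)
    ... | no w≢v₀  | no _     | no w∉Nv  = remote (x∉p⇒x∈∁p λ w∈ →
      [ w∉Nv , (λ w∈⁅v₀⁆ → w≢v₀ (x∈⁅y⁆⇒x≡y _ w∈⁅v₀⁆)) ]′ (x∈p∪q⁻ (C.neighbours v₀) _ w∈))

    ∣N₀∣≤∣D∣ : ∣ N₀ ∣ ≤ ∣ D ∣
    ∣N₀∣≤∣D∣ = ℕₚ.≤-reflexive (trans ∣N₀∣≡d (sym ∣D∣≡d))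

    place : ∀ {w} → Role w → Fin (n K)
    place (centre _)    = x
    place (target _)    = y
    place (neighbour p) = inject N₀ D ∣N₀∣≤∣D∣ p
    place (remote p)    = inject far W′ ∣far∣≤∣W′∣ p

    φ : Fin (n C₀) → Fin (n K)
    φ w = place (role w)

    W′-∈ : ∀ {z} → z ∈ W′ → z ∈ W × z ∉ D × z ≢ y
    W′-∈ z∈ = let z∈W , z∉ = x∈p∩q⁻ _ _ z∈ in
      z∈W , (λ z∈D → x∈∁p⇒x∉p z∉ (p⊆p∪q _ z∈D))
          , (λ z≡y → x∈∁p⇒x∉p z∉ (q⊆p∪q _ _ (subst (_∈ ⁅ y ⁆) (sym z≡y) (x∈⁅x⁆ y))))

    neighbour∈D : ∀ {w} (p : w ∈ N₀) → place (neighbour p) ∈ D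
    neighbour∈D = inject-∈ N₀ D ∣N₀∣≤∣D∣

    remote∈W′ : ∀ {w} (p : w ∈ far) → place (remote p) ∈ W′
    remote∈W′ = inject-∈ far W′ ∣far∣≤∣W′∣

    place-injective : ∀ {w w′} (ρ : Role w) (ρ′ : Role w′) → place ρ ≡ place ρ′ → w ≡ w′
    place-injective (centre p)    (centre q)    _  = trans p (sym q)
    place-injective (target p)    (target q)    _  = trans p (sym q)
    place-injective (neighbour p) (neighbour q) eq = inject-injective N₀ D ∣N₀∣≤∣D∣ p q eq
    place-injective (remote p)    (remote q)    eq = inject-injective far W′ ∣far∣≤∣W′∣ p q eq
    place-injective (centre _)    (target _)    eq = contradiction (subst (_∈ W) (sym eq) y∈W) x∉W
    place-injective (centre _)    (neighbour q) eq = contradiction (subst (_∈ W) (sym eq) (D⊆W (neighbour∈D q))) x∉W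
    place-injective (centre _)    (remote q)    eq = contradiction (subst (_∈ W) (sym eq) (proj₁ (W′-∈ (remote∈W′ q)))) x∉W
    place-injective (target _)    (centre _)    eq = contradiction (subst (_∈ W) eq y∈W) x∉W
    place-injective (target _)    (neighbour q) eq = contradiction (subst (_∈ D) (sym eq) (neighbour∈D q)) y∉D
    place-injective (target _)    (remote q)    eq = contradiction (sym eq) (proj₂ (proj₂ (W′-∈ (remote∈W′ q))))
    place-injective (neighbour p) (centre _)    eq = contradiction (subst (_∈ W) eq (D⊆W (neighbour∈D p))) x∉W
    place-injective (neighbour p) (target _)    eq = contradiction (subst (_∈ D) eq (neighbour∈D p)) y∉D
    place-injective (neighbour p) (remote q)    eq =
      contradiction (subst (_∈ D) eq (neighbour∈D p)) (proj₁ (proj₂ (W′-∈ (remote∈W′ q))))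
    place-injective (remote p)    (centre _)    eq = contradiction (subst (_∈ W) eq (proj₁ (W′-∈ (remote∈W′ p)))) x∉W
    place-injective (remote p)    (target _)    eq = contradiction eq (proj₂ (proj₂ (W′-∈ (remote∈W′ p))))
    place-injective (remote p)    (neighbour q) eq =
      contradiction (subst (_∈ D) (sym eq) (neighbour∈D q)) (proj₁ (proj₂ (W′-∈ (remote∈W′ p))))

    φ-injective : Injective _≡_ _≡_ φ
    φ-injective {w} {w′} = place-injective (role w) (role w′)

    v₀≢w₀ : v₀ ≢ w₀
    v₀≢w₀ = C.joins-≢ e₀-joins

    N₀⊆neighbours : N₀ ⊆ C.neighbours v₀
    N₀⊆neighbours = x∈p-y⇒x∈p

    place-v₀ : ∀ {w} (ρ : Role w) → w ≡ v₀ → place ρ ≡ x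
    place-v₀ (centre _)    _    = refl
    place-v₀ (target p)    refl = contradiction p v₀≢w₀
    place-v₀ (neighbour p) refl = contradiction (N₀⊆neighbours p) v₀∉neighbours
    place-v₀ (remote p)    refl = contradiction (q⊆p∪q _ _ (x∈⁅x⁆ v₀)) (x∈∁p⇒x∉p p)

    place-w₀ : ∀ {w} (ρ : Role w) → w ≡ w₀ → place ρ ≡ y
    place-w₀ (centre p)    refl = contradiction (sym p) v₀≢w₀
    place-w₀ (target _)    _    = refl
    place-w₀ (neighbour p) refl = contradiction refl (x∈p-y⇒x≢y p)
    place-w₀ (remote p)    refl = contradiction (p⊆p∪q _ w₀∈neighbours) (x∈∁p⇒x∉p p)

    place-N₀ : ∀ {w} (ρ : Role w) → w ∈ N₀ → place ρ ∈ D
    place-N₀ (centre refl) w∈ = contradiction (N₀⊆neighbours w∈) v₀∉neighbours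
    place-N₀ (target refl) w∈ = contradiction refl (x∈p-y⇒x≢y w∈)
    place-N₀ (neighbour p) _  = neighbour∈D p
    place-N₀ (remote p)    w∈ = contradiction (p⊆p∪q _ (N₀⊆neighbours w∈)) (x∈∁p⇒x∉p p)

    place-W : ∀ {w} (ρ : Role w) → w ≢ v₀ → place ρ ∈ W
    place-W (centre p)    w≢v₀ = contradiction p w≢v₀
    place-W (target _)    _    = y∈W
    place-W (neighbour p) _    = D⊆W (neighbour∈D p)
    place-W (remote p)    _    = proj₁ (W′-∈ (remote∈W′ p))

    other∈N₀ : ∀ {j} → j ∈ ⊤ - e₀ → (t : C.Touches j v₀) → C.other t ∈ N₀
    other∈N₀ j∈ t = x∈p∧x≢y⇒x∈p-y (∈-subsetOf⁺ (C.adj? v₀) (_ , C.other-joins t))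
      λ w≡w₀ → x∈p-y⇒x≢y j∈ (C.joins-unique (subst (Joins C₀ _ v₀) w≡w₀ (C.other-joins t)) e₀-joins)

    open Extension C₀ φ φ-injective

    Z : Subset (m K)
    Z = clique W ∪ between ⁅ x ⁆ D

    image-C₀-e₀⊆Z : image edgeMap (⊤ - e₀) ⊆ Z
    image-C₀-e₀⊆Z = image-⊆ edgeMap (⊤ - e₀) Z λ {j} j∈ → case C.touches? j v₀ of λ where
      (yes j-at-v₀) → q⊆p∪q _ _ (∈-between⁺ (subst (λ z → Joins K (edgeMap j) z (φ (C.other j-at-v₀))) (place-v₀ (role v₀) refl)
                                                   (edgeMap-joins (C.other-joins j-at-v₀)))
                                    (x∈⁅x⁆ x) (place-N₀ (role _) (other∈N₀ j∈ j-at-v₀)))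
      (no ¬j-at-v₀) → p⊆p∪q _ (∈-clique⁺ (edgeMap-joins (C.joins-self j))
                                (place-W (role _) (¬j-at-v₀ ∘ inj₁)) (place-W (role _) (¬j-at-v₀ ∘ inj₂)))

    x≢y : x ≢ y
    x≢y x≡y = x∉W (subst (_∈ W) (sym x≡y) y∈W)

    edgeMap-e₀ : edgeMap e₀ ≡ edge x≢y
    edgeMap-e₀ = joins-unique (subst₂ (Joins K (edgeMap e₀)) (place-v₀ (role v₀) refl) (place-w₀ (role w₀) refl)
                                      (edgeMap-joins e₀-joins))
                              (edge-joins x≢y)

    xy-spanned : Spans Z (edge x≢y)
    xy-spanned = subst (Spans Z) edgeMap-e₀ (spans-⊆ image-C₀-e₀⊆Z (begin
      rank M K (image edgeMap (⊤ - e₀) ∪ ⁅ edgeMap e₀ ⁆)     ≡⟨ cong (λ X → rank M K (image edgeMap (⊤ - e₀) ∪ X))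
                                                                      (sym (image-⁅⁆ edgeMap e₀)) ⟩
      rank M K (image edgeMap (⊤ - e₀) ∪ image edgeMap ⁅ e₀ ⁆) ≡⟨ cong (rank M K) (sym (image-∪ edgeMap (⊤ - e₀) ⁅ e₀ ⁆)) ⟩
      rank M K (image edgeMap ((⊤ - e₀) ∪ ⁅ e₀ ⁆))           ≡⟨ cong (rank M K ∘ image edgeMap) (p-x∪⁅x⁆≡p ∈⊤) ⟩
      rank M K (image edgeMap ⊤)                             ≡⟨ sym (compat M C₀ K embedding ⊤) ⟩
      rank M C₀ ⊤                                            ≡⟨ e₀-spanned ⟩
      rank M C₀ (⊤ - e₀)                                     ≡⟨ compat M C₀ K embedding (⊤ - e₀) ⟩
      rank M K (image edgeMap (⊤ - e₀)) ∎))
      where open ≡-Reasoning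

  module CliqueUpperBound (K : Graph) (K-complete : IsComplete K) where
    open Complete K K-complete
    open MatroidRank (matroid M K)

    r-clique-∪⁅x⁆≤ : ∀ {W x D} → x ∉ W → D ⊆ W → ∣ D ∣ ≡ d → t ≤ ∣ W ∣ →
                     rank M K (clique (W ∪ ⁅ x ⁆)) ≤ rank M K (clique W) + d
    r-clique-∪⁅x⁆≤ {W} {x} {D} x∉W D⊆W ∣D∣≡d t≤∣W∣ = begin
      rank M K (clique (W ∪ ⁅ x ⁆))                       ≤⟨ spansAll⇒r≤ Z _ spanned ⟩
      rank M K Z                                          ≤⟨ r-∪-≤ (clique W) _ ⟩
      rank M K (clique W) + rank M K (between ⁅ x ⁆ D)    ≤⟨ ℕₚ.+-monoʳ-≤ _ (IsMatroidRank.bounded (matroid M K) _) ⟩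
      rank M K (clique W) + ∣ between ⁅ x ⁆ D ∣           ≤⟨ ℕₚ.+-monoʳ-≤ _ (ℕₚ.≤-trans (∣between⁅x⁆D∣≤∣D∣ x D)
                                                                                    (ℕₚ.≤-reflexive ∣D∣≡d)) ⟩
      rank M K (clique W) + d ∎
      where
      open ℕₚ.≤-Reasoning
      Z : Subset (m K)
      Z = clique W ∪ between ⁅ x ⁆ D
      fromX : ∀ {f w} → Joins K f x w → w ∈ W → Spans Z f
      fromX {f} {w} f-joins w∈W with w ∈? D
      ... | yes w∈D = ∈⇒spans (q⊆p∪q _ _ (∈-between⁺ f-joins (x∈⁅x⁆ x) w∈D))
      ... | no w∉D  = subst (Spans Z) (sym (joins-unique f-joins (edge-joins x≢w))) xw-spanned
        where
        open Placement K K-complete x∉W w∈W w∉D D⊆W ∣D∣≡d t≤∣W∣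
          using () renaming (x≢y to x≢w; xy-spanned to xw-spanned)
      spanned : ∀ {f} → f ∈ clique (W ∪ ⁅ x ⁆) → Spans Z f
      spanned {f} f∈ with ∈-clique⁻ f∈ (joins-self f)
      ... | u∈ , v∈ with x∈p∪q⁻ W _ u∈ | x∈p∪q⁻ W _ v∈
      ... | inj₁ u∈W  | inj₁ v∈W  = ∈⇒spans (p⊆p∪q _ (∈-clique⁺ (joins-self f) u∈W v∈W))
      ... | inj₂ u∈⁅x⁆ | inj₁ v∈W  = fromX (subst (λ u → Joins K f u _) (x∈⁅y⁆⇒x≡y _ u∈⁅x⁆) (joins-self f)) v∈W
      ... | inj₁ u∈W  | inj₂ v∈⁅x⁆ = fromX (subst (λ v → Joins K f v _) (x∈⁅y⁆⇒x≡y _ v∈⁅x⁆) (joins-sym (joins-self f))) u∈W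
      ... | inj₂ u∈⁅x⁆ | inj₂ v∈⁅x⁆ =
        contradiction (trans (x∈⁅y⁆⇒x≡y _ u∈⁅x⁆) (sym (x∈⁅y⁆⇒x≡y _ v∈⁅x⁆))) (end₁≢end₂ f)

    r-clique-∪≤ : ∀ {T D} → D ⊆ T → ∣ D ∣ ≡ d → t ≤ ∣ T ∣ → ∀ U → (∀ {z} → z ∈ U → z ∉ T) →
                  rank M K (clique (T ∪ U)) ≤ rank M K (clique T) + ∣ U ∣ * d
    r-clique-∪≤ {T} {D} D⊆T ∣D∣≡d t≤∣T∣ = removal-induction _ (λ _ → base) λ {U} {x} x∈U ih U-avoids-T → begin
      rank M K (clique (T ∪ U))
        ≡⟨ cong (rank M K ∘ clique) (trans (cong (T ∪_) (sym (p-x∪⁅x⁆≡p x∈U))) (sym (∪-assoc T _ _))) ⟩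
      rank M K (clique ((T ∪ (U - x)) ∪ ⁅ x ⁆))
        ≤⟨ r-clique-∪⁅x⁆≤ (x∉T∪U-x x∈U U-avoids-T) (p⊆p∪q _ ∘ D⊆T) ∣D∣≡d
                          (ℕₚ.≤-trans t≤∣T∣ (p⊆q⇒∣p∣≤∣q∣ (p⊆p∪q {p = T} (U - x)))) ⟩
      rank M K (clique (T ∪ (U - x))) + d
        ≤⟨ ℕₚ.+-monoˡ-≤ d (ih (U-avoids-T ∘ x∈p-y⇒x∈p)) ⟩
      rank M K (clique T) + ∣ U - x ∣ * d + d
        ≡⟨ trans (ℕₚ.+-assoc (rank M K (clique T)) (∣ U - x ∣ * d) d) (cong (rank M K (clique T) +_) (ℕₚ.+-comm (∣ U - x ∣ * d) d)) ⟩
      rank M K (clique T) + suc ∣ U - x ∣ * d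
        ≡⟨ cong (λ s → rank M K (clique T) + s * d) (x∈p⇒suc∣p-x∣≡∣p∣ x∈U) ⟩
      rank M K (clique T) + ∣ U ∣ * d ∎
      where
      open ℕₚ.≤-Reasoning
      base : rank M K (clique (T ∪ ⊥)) ≤ rank M K (clique T) + ∣ ⊥ {n K} ∣ * d
      base = ℕₚ.≤-reflexive (begin-equality
        rank M K (clique (T ∪ ⊥))   ≡⟨ cong (rank M K ∘ clique) (∪-identityʳ T) ⟩
        rank M K (clique T)         ≡⟨ sym (ℕₚ.+-identityʳ _) ⟩
        rank M K (clique T) + 0     ≡⟨ cong (λ s → rank M K (clique T) + s * d) (sym (∣⊥∣≡0 (n K))) ⟩
        rank M K (clique T) + ∣ ⊥ {n K} ∣ * d ∎)
      x∉T∪U-x : ∀ {U x} → x ∈ U → (∀ {z} → z ∈ U → z ∉ T) → x ∉ T ∪ (U - x)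
      x∉T∪U-x x∈U U-avoids-T x∈ = [ U-avoids-T x∈U , (λ x∈U-x → x∈p-y⇒x≢y x∈U-x refl) ]′ (x∈p∪q⁻ T _ x∈)

-- Vertical connectivity forces vertex connectivity

m≤n*n : (G : Graph) → m G ≤ n G * n G
m≤n*n G = Finₚ.injective⇒≤ {f = λ e → Fin.combine (proj₁ (ends G e)) (proj₂ (ends G e))} λ {e} {f} eq →
  let end₁≡ , end₂≡ = Finₚ.combine-injective (proj₁ (ends G e)) (proj₂ (ends G e)) (proj₁ (ends G f)) (proj₂ (ends G f)) eq
  in simple G (cong₂ _,_ end₁≡ end₂≡)

largeCompleteGraph : (M : GraphMatroidFamily) → Unbounded M → ∀ N → ∃[ H ] IsComplete H × N < n H × N < r M H
largeCompleteGraph M unbounded N with unbounded (N * N + N)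
... | H , H-complete , N*N+N<rH = H , H-complete , N<nH , ℕₚ.≤-<-trans (ℕₚ.m≤n+m N (N * N)) N*N+N<rH
  where
  N<nH : N < n H
  N<nH = ℕₚ.≰⇒> λ nH≤N → ℕₚ.<⇒≱ N*N+N<rH (begin
    r M H             ≤⟨ IsMatroidRank.bounded (matroid M H) ⊤ ⟩
    ∣ ⊤ {m H} ∣       ≡⟨ ∣⊤∣≡n (m H) ⟩
    m H               ≤⟨ m≤n*n H ⟩
    n H * n H         ≤⟨ ℕₚ.*-mono-≤ nH≤N nH≤N ⟩
    N * N             ≤⟨ ℕₚ.m≤m+n (N * N) N ⟩
    N * N + N ∎)
    where open ℕₚ.≤-Reasoning

module ConnectivityArgument (M : GraphMatroidFamily) {d t : ℕ} (dim : IsDimensionality M d) (thr : IsThreshold M d t)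
                            {k : ℕ} (t≤k : t ≤ k) (K : Graph) (K-complete : IsComplete K) (K-size : n K ≡ k) where

  dim-min : CircuitDegreeBound M d
  dim-min = proj₂ dim

  open ThresholdCircuit M (proj₁ (proj₁ thr)) (proj₁ (proj₂ (proj₁ thr)))
                         (proj₁ (proj₂ (proj₂ (proj₁ thr)))) (proj₂ (proj₂ (proj₂ (proj₁ thr))))
    using (d<t; module CliqueUpperBound)

  rK : ℕ
  rK = r M K

  d<k : d < k
  d<k = ℕₚ.<-≤-trans d<t t≤k

  -- The k − 1 edges of a star in K_k are independent once d ≥ 1.
  k≤1+rK : 0 < d → k ≤ suc rK
  k≤1+rK 0<d = begin
    k
      ≡⟨ sym K-size ⟩
    n K
      ≡⟨ sym (trans (x∈p⇒suc∣p-x∣≡∣p∣ {p = ⊤} {x = z} ∈⊤) (∣⊤∣≡n (n K))) ⟩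
    suc ∣ ⊤ - z ∣
      ≡⟨ cong suc (sym (trans (cong₂ _+_ r⊥≡0 (cong (∣ ⊤ - z ∣ *_) (∣⁅x⁆∣≡1 z))) (ℕₚ.*-identityʳ _))) ⟩
    suc (rank M K ⊥ + ∣ ⊤ - z ∣ * ∣ ⁅ z ⁆ ∣)
      ≤⟨ s≤s (r-∪-between≥ ⊥ (ℕₚ.≤-trans (ℕₚ.≤-reflexive (∣⁅x⁆∣≡1 z)) 0<d) (⊤ - z) (λ _ f∈⊥ → contradiction f∈⊥ ∉⊥)
                            (λ y∈ y∈⁅z⁆ → x∈p-y⇒x≢y y∈ (x∈⁅y⁆⇒x≡y z y∈⁅z⁆))) ⟩
    suc (rank M K (⊥ ∪ between (⊤ - z) ⁅ z ⁆))
      ≤⟨ s≤s (mono ⊆⊤) ⟩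
    suc rK ∎
    where
    open ℕₚ.≤-Reasoning
    open Complete K K-complete
    open MatroidRank (matroid M K)
    open CliqueLowerBound M dim-min K K-complete
    z : Fin (n K)
    z = subst Fin (sym K-size) (Fin.fromℕ< (ℕₚ.≤-<-trans z≤n d<k))

  module Host (H : Graph) (H-complete : IsComplete H) (k≤nH : k ≤ n H) where
    open Complete H H-complete
    open MatroidRank (matroid M H)
    open CliqueUpperBound H H-complete
    open CliqueLowerBound M dim-min H H-complete

    R : Subset (m H) → ℕ
    R = rank M H

    clique-rank : (T : Subset (n H)) → ∣ T ∣ ≡ k → R (clique T) ≡ rK
    clique-rank T ∣T∣≡k = sym (trans (compat M K H embedding ⊤) (cong R image≡clique))
      where
      nK≡∣T∣ : n K ≡ ∣ T ∣
      nK≡∣T∣ = trans K-size (sym ∣T∣≡k)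
      φ : Fin (n K) → Fin (n H)
      φ i = enum T (Fin.cast nK≡∣T∣ i)
      φ-injective : Injective _≡_ _≡_ φ
      φ-injective {i} {j} eq = trans (sym (Finₚ.cast-involutive (sym nK≡∣T∣) nK≡∣T∣ i))
        (trans (cong (Fin.cast (sym nK≡∣T∣)) (enum-injective T eq)) (Finₚ.cast-involutive (sym nK≡∣T∣) nK≡∣T∣ j))
      open Extension K φ φ-injective
      preimage : ∀ {u} → u ∈ T → ∃[ a ] φ a ≡ u
      preimage u∈T = Fin.cast (sym nK≡∣T∣) (index T u∈T) ,
        trans (cong (enum T) (Finₚ.cast-involutive nK≡∣T∣ (sym nK≡∣T∣) _)) (enum-index T u∈T)
      image≡clique : image edgeMap ⊤ ≡ clique T
      image≡clique = ⊆-antisym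
        (image-⊆ edgeMap ⊤ (clique T) λ {j} _ → ∈-clique⁺ (edgeMap-joins (GraphProperties.joins-self K j)) (enum-∈ T _) (enum-∈ T _))
        λ {f} f∈ →
          let u∈ , v∈ = ∈-clique⁻ f∈ (joins-self f)
              a , φa≡u = preimage u∈
              b , φb≡v = preimage v∈
              j , j-joins = complete-joins K K-complete {a} {b} λ a≡b → end₁≢end₂ f (trans (sym φa≡u) (trans (cong φ a≡b) φb≡v))
          in subst (_∈ image edgeMap ⊤) (joins-unique (subst₂ (Joins H (edgeMap j)) φa≡u φb≡v (edgeMap-joins j-joins)) (joins-self f))
                   (∈-image⁺ edgeMap ⊤ ∈⊤)

    subsetOfSize-d : (T : Subset (n H)) → ∣ T ∣ ≡ k → ∃[ D ] D ⊆ T × ∣ D ∣ ≡ d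
    subsetOfSize-d T ∣T∣≡k = ⊆-ofSize T (subst (d ≤_) (sym ∣T∣≡k) (ℕₚ.<⇒≤ d<k))

    r-clique-∪≤ʳ : (T : Subset (n H)) → ∣ T ∣ ≡ k → ∀ U → (∀ {z} → z ∈ U → z ∉ T) → R (clique (T ∪ U)) ≤ rK + ∣ U ∣ * d
    r-clique-∪≤ʳ T ∣T∣≡k U U-avoids-T =
      let D , D⊆T , ∣D∣≡d = subsetOfSize-d T ∣T∣≡k
      in subst (λ s → R (clique (T ∪ U)) ≤ s + ∣ U ∣ * d) (clique-rank T ∣T∣≡k)
               (r-clique-∪≤ D⊆T ∣D∣≡d (subst (t ≤_) (sym ∣T∣≡k) t≤k) U U-avoids-T)

    r-cliquePair≥ : (T : Subset (n H)) → ∣ T ∣ ≡ k → ∀ P →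
                    rK + ∣ ∁ T ∣ * d ≤ R (clique (T ∪ (∁ T ∩ P)) ∪ clique (T ∪ (∁ T ∩ ∁ P)))
    r-cliquePair≥ T ∣T∣≡k P with subsetOfSize-d T ∣T∣≡k
    ... | D , D⊆T , ∣D∣≡d = begin
      rK + ∣ ∁ T ∣ * d                               ≡⟨ cong₂ (λ r s → r + ∣ ∁ T ∣ * s) (sym (clique-rank T ∣T∣≡k)) (sym ∣D∣≡d) ⟩
      R (clique T) + ∣ ∁ T ∣ * ∣ D ∣                 ≤⟨ r-∪-between≥ (clique T) (ℕₚ.≤-reflexive ∣D∣≡d) (∁ T)
                                                          (λ z∈ → clique-avoids (x∈∁p⇒x∉p z∈))
                                                          (λ z∈ z∈D → x∈∁p⇒x∉p z∈ (D⊆T z∈D)) ⟩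
      R (clique T ∪ between (∁ T) D)                 ≤⟨ mono (∪-least (p⊆p∪q _ ∘ clique-mono (p⊆p∪q _)) between⊆) ⟩
      R (clique (T ∪ (∁ T ∩ P)) ∪ clique (T ∪ (∁ T ∩ ∁ P))) ∎
      where
      open ℕₚ.≤-Reasoning
      between⊆ : between (∁ T) D ⊆ clique (T ∪ (∁ T ∩ P)) ∪ clique (T ∪ (∁ T ∩ ∁ P))
      between⊆ f∈ with ∈-between⁻ f∈
      ... | w , y , j , w∈∁T , y∈D with w ∈? P
      ...   | yes w∈P = p⊆p∪q _ (∈-clique⁺ j (q⊆p∪q _ _ (x∈p∩q⁺ (w∈∁T , w∈P))) (p⊆p∪q _ (D⊆T y∈D)))
      ...   | no w∉P  = q⊆p∪q _ _ (∈-clique⁺ j (q⊆p∪q _ _ (x∈p∩q⁺ (w∈∁T , x∉p⇒x∈∁p w∉P))) (p⊆p∪q _ (D⊆T y∈D)))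

    -- For d = 0 the threshold bound would cap the rank of every complete graph at r(K_k).
    0<d : rK < r M H → 0 < d
    0<d rK<rH with ⊆-ofSize ⊤ (subst (k ≤_) (sym (∣⊤∣≡n (n H))) k≤nH)
    ... | T , _ , ∣T∣≡k = ℕₚ.n≢0⇒n>0 λ d≡0 → ℕₚ.<⇒≱ rK<rH (begin
      R ⊤                           ≡⟨ cong R (⊆-antisym (λ {f} _ → ∈-clique⁺ (joins-self f) ∈⊤ ∈⊤) ⊆⊤) ⟩
      R (clique ⊤)                  ≡⟨ cong (R ∘ clique) (sym (p∪∁p≡⊤ T)) ⟩
      R (clique (T ∪ ∁ T))          ≤⟨ r-clique-∪≤ʳ T ∣T∣≡k (∁ T) x∈∁p⇒x∉p ⟩
      rK + ∣ ∁ T ∣ * d              ≡⟨ cong (λ s → rK + ∣ ∁ T ∣ * s) d≡0 ⟩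
      rK + ∣ ∁ T ∣ * 0              ≡⟨ trans (cong (rK +_) (ℕₚ.*-zeroʳ ∣ ∁ T ∣)) (ℕₚ.+-identityʳ rK) ⟩
      rK ∎)
      where open ℕₚ.≤-Reasoning

    module Embedded (G : Graph) (nG≤nH : n G ≤ n H) where
      private module G = GraphProperties G
      private module ρ = MatroidRank (matroid M G)

      ι : Fin (n G) → Fin (n H)
      ι i = Fin.inject≤ i nG≤nH

      ι-injective : Injective _≡_ _≡_ ι
      ι-injective = Finₚ.inject≤-injective nG≤nH nG≤nH _ _

      open Extension G ι ι-injective

      ρ : Subset (m G) → ℕ
      ρ = rank M G

      ρ≡R∘image : ∀ X → ρ X ≡ R (image edgeMap X)
      ρ≡R∘image = compat M G H embedding

      image-touching⊆clique : ∀ {S A T} → Reachability.Closed G S A → image ι S ⊆ T →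
                              image edgeMap (G.touching A) ⊆ clique (T ∪ (∁ T ∩ image ι A))
      image-touching⊆clique {S} {A} {T} closed ιS⊆T = image-⊆ edgeMap (G.touching A) _ λ {j} j∈ →
        ∈-clique⁺ (edgeMap-joins (G.joins-self j)) (ιw∈ (touching-ends closed j∈ (inj₁ refl)))
                                                  (ιw∈ (touching-ends closed j∈ (inj₂ refl)))
        where
        open Reachability G S using (touching-ends)
        ιw∈ : ∀ {w} → w ∈ A ⊎ w ∈ S → ι w ∈ T ∪ (∁ T ∩ image ι A)
        ιw∈ (inj₁ w∈A) = x∈p⇒x∈q∪[∁q∩p] (∈-image⁺ ι A w∈A)
        ιw∈ (inj₂ w∈S) = p⊆p∪q _ (ιS⊆T (∈-image⁺ ι S w∈S))

      image-∁touching⊆clique : ∀ {A T} → image edgeMap (∁ (G.touching A)) ⊆ clique (T ∪ (∁ T ∩ ∁ (image ι A)))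
      image-∁touching⊆clique {A} {T} = image-⊆ edgeMap (∁ (G.touching A)) _ λ {j} j∈ →
        ∈-clique⁺ (edgeMap-joins (G.joins-self j)) (ιw∈ (G.¬touching-ends (x∈∁p⇒x∉p j∈) (inj₁ refl)))
                                                  (ιw∈ (G.¬touching-ends (x∈∁p⇒x∉p j∈) (inj₂ refl)))
        where
        ιw∈ : ∀ {w} → w ∉ A → ι w ∈ T ∪ (∁ T ∩ ∁ (image ι A))
        ιw∈ w∉A = x∈p⇒x∈q∪[∁q∩p] (x∉p⇒x∈∁p (w∉A ∘ ∈-image-injective ι ι-injective A))

      ρ-split≤ρ⊤+rK : ∀ {S A} → ∣ S ∣ ≤ k → Reachability.Closed G S A →
                      ρ (G.touching A) + ρ (∁ (G.touching A)) ≤ ρ ⊤ + rK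
      ρ-split≤ρ⊤+rK {S} {A} ∣S∣≤k closed with ⊇-ofSize (image ι S) (ℕₚ.≤-trans (∣image∣≤ ι S) ∣S∣≤k) k≤nH
      ... | T , ιS⊆T , ∣T∣≡k = ℕₚ.+-cancelʳ-≤ (rK + ∣ ∁ T ∣ * d) _ _ (begin
        ρ X + ρ Y + (rK + ∣ ∁ T ∣ * d)
          ≡⟨ cong₂ (λ a b → a + b + (rK + ∣ ∁ T ∣ * d)) (ρ≡R∘image X) (ρ≡R∘image Y) ⟩
        R X̂ + R Ŷ + (rK + ∣ ∁ T ∣ * d)
          ≤⟨ ℕₚ.+-monoʳ-≤ (R X̂ + R Ŷ) (r-cliquePair≥ T ∣T∣≡k Â) ⟩
        R X̂ + R Ŷ + R (clique V₁ ∪ clique V₂)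
          ≤⟨ localConnectivity-mono (image-touching⊆clique closed ιS⊆T) image-∁touching⊆clique ⟩
        R (clique V₁) + R (clique V₂) + R (X̂ ∪ Ŷ)
          ≤⟨ ℕₚ.+-monoˡ-≤ (R (X̂ ∪ Ŷ)) (ℕₚ.+-mono-≤ (r-clique-∪≤ʳ T ∣T∣≡k U₁ (avoids Â)) (r-clique-∪≤ʳ T ∣T∣≡k U₂ (avoids (∁ Â)))) ⟩
        (rK + ∣ U₁ ∣ * d) + (rK + ∣ U₂ ∣ * d) + R (X̂ ∪ Ŷ)
          ≡⟨ regroup rK (∣ U₁ ∣ * d) (∣ U₂ ∣ * d) (R (X̂ ∪ Ŷ)) ⟩
        (R (X̂ ∪ Ŷ) + rK) + (rK + (∣ U₁ ∣ * d + ∣ U₂ ∣ * d))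
          ≡⟨ cong₂ (λ a b → a + rK + (rK + b)) X̂∪Ŷ≡ (sym ∣∁T∣*d≡) ⟩
        ρ ⊤ + rK + (rK + ∣ ∁ T ∣ * d) ∎)
        where
        open ℕₚ.≤-Reasoning
        open +-*-Solver
        regroup : ∀ a b c q → (a + b) + (a + c) + q ≡ (q + a) + (a + (b + c))
        regroup = solve 4 (λ a b c q → (a :+ b) :+ (a :+ c) :+ q := (q :+ a) :+ (a :+ (b :+ c))) refl
        X Y : Subset (m G)
        X = G.touching A
        Y = ∁ (G.touching A)
        X̂ Ŷ : Subset (m H)
        X̂ = image edgeMap X
        Ŷ = image edgeMap Y
        Â U₁ U₂ V₁ V₂ : Subset (n H)
        Â = image ι A
        U₁ = ∁ T ∩ Â
        U₂ = ∁ T ∩ ∁ Â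
        V₁ = T ∪ U₁
        V₂ = T ∪ U₂
        avoids : ∀ Q {z} → z ∈ ∁ T ∩ Q → z ∉ T
        avoids Q z∈ = x∈∁p⇒x∉p (proj₁ (x∈p∩q⁻ (∁ T) Q z∈))
        X̂∪Ŷ≡ : R (X̂ ∪ Ŷ) ≡ ρ ⊤
        X̂∪Ŷ≡ = trans (cong R (trans (sym (image-∪ edgeMap X Y)) (cong (image edgeMap) (p∪∁p≡⊤ X)))) (sym (ρ≡R∘image ⊤))
        ∣∁T∣*d≡ : ∣ ∁ T ∣ * d ≡ ∣ U₁ ∣ * d + ∣ U₂ ∣ * d
        ∣∁T∣*d≡ = trans (cong (_* d) (∣p∣≡∣p∩q∣+∣p∩∁q∣ (∁ T) Â)) (ℕₚ.*-distribʳ-+ d ∣ U₁ ∣ ∣ U₂ ∣)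

      module _ (0<d : 0 < d) (noIsolated : NoIsolated G) where
        open LowDegree M dim-min G using (avoidsVertex⇒r<r⊤)

        edgeAt : ∀ x → Nonempty (incident G x)
        edgeAt x = 0<∣p∣⇒Nonempty (incident G x) (noIsolated x)

        ρ[∁touching]<ρ⊤ : ∀ {A u} → u ∈ A → ρ (∁ (G.touching A)) < ρ ⊤
        ρ[∁touching]<ρ⊤ {A} {u} u∈A with edgeAt u
        ... | e , e∈ = avoidsVertex⇒r<r⊤ 0<d (∁ (G.touching A)) (x∈p⇒x∉∁p (touching∋e (G.∈-incident⁻ e∈)))
                                          (G.∈-incident⁻ e∈) (λ f∈ t → G.¬touching-ends (x∈∁p⇒x∉p f∈) t u∈A)
          where
          touching∋e : G.Touches e u → e ∈ G.touching A
          touching∋e (inj₁ refl) = ∈-subsetOf⁺ (G.touching? A) (inj₁ u∈A)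
          touching∋e (inj₂ refl) = ∈-subsetOf⁺ (G.touching? A) (inj₂ u∈A)

        separator⇒smallSplit : ∀ {S A u v} → ∣ S ∣ < k + 1 → Reachability.Closed G S A → v ∉ S → u ∈ A → v ∉ A →
                               ρ.SmallSplit rK (G.touching A)
        separator⇒smallSplit {S} {A} {u} {v} ∣S∣<k+1 closed v∉S u∈A v∉A with edgeAt v
        ... | e , e∈ = avoidsVertex⇒r<r⊤ 0<d (G.touching A) (λ e∈X → v∉A∪S (touching-ends closed e∈X (G.∈-incident⁻ e∈)))
                                          (G.∈-incident⁻ e∈) (λ f∈ t → v∉A∪S (touching-ends closed f∈ t))
                     , ρ[∁touching]<ρ⊤ u∈A , ρ-split≤ρ⊤+rK (ℕₚ.m<1+n⇒m≤n (subst (∣ S ∣ <_) (ℕₚ.+-comm k 1) ∣S∣<k+1)) closed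
          where
          open Reachability G S using (touching-ends)
          v∉A∪S : ¬ (v ∈ A ⊎ v ∈ S)
          v∉A∪S = [ v∉A , v∉S ]′

        fewVertices⇒smallSplit : rK + 2 ≤ ρ ⊤ → n G ≤ k + 1 → ∀ x → ρ.SmallSplit rK (G.touching ⁅ x ⁆)
        fewVertices⇒smallSplit rK+2≤ρ⊤ nG≤k+1 x = ρX<ρ⊤ , ρ[∁touching]<ρ⊤ (x∈⁅x⁆ x) , ρ-split≤ρ⊤+rK ∣⊤-x∣≤k closed
          where
          ∣⊤-x∣≤k : ∣ ⊤ - x ∣ ≤ k
          ∣⊤-x∣≤k = ℕₚ.≤-pred (begin
            suc ∣ ⊤ - x ∣   ≡⟨ trans (x∈p⇒suc∣p-x∣≡∣p∣ {p = ⊤} {x = x} ∈⊤) (∣⊤∣≡n (n G)) ⟩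
            n G             ≤⟨ nG≤k+1 ⟩
            k + 1           ≡⟨ ℕₚ.+-comm k 1 ⟩
            suc k ∎)
            where open ℕₚ.≤-Reasoning
          closed : Reachability.Closed G (⊤ - x) ⁅ x ⁆
          closed {w = w} _ _ w∉⊤-x with w Finₚ.≟ x
          ... | yes refl = x∈⁅x⁆ x
          ... | no w≢x   = contradiction (x∈p∧x≢y⇒x∈p-y ∈⊤ w≢x) w∉⊤-x
          touching⊆incident : G.touching ⁅ x ⁆ ⊆ incident G x
          touching⊆incident e∈ = G.∈-incident⁺ (Sum.map (λ end∈ → x∈⁅y⁆⇒x≡y x end∈) (λ end∈ → x∈⁅y⁆⇒x≡y x end∈)
                                                              (∈-subsetOf⁻ (G.touching? ⁅ x ⁆) e∈))
          neighbours⊆⊤-x : G.neighbours x ⊆ ⊤ - x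
          neighbours⊆⊤-x w∈ = x∈p∧x≢y⇒x∈p-y ∈⊤ (G.joins-≢ (proj₂ (∈-subsetOf⁻ (G.adj? x) w∈)) ∘ sym)
          ρX<ρ⊤ : ρ (G.touching ⁅ x ⁆) < ρ ⊤
          ρX<ρ⊤ = begin-strict
            ρ (G.touching ⁅ x ⁆)      ≤⟨ IsMatroidRank.bounded (matroid M G) _ ⟩
            ∣ G.touching ⁅ x ⁆ ∣      ≤⟨ p⊆q⇒∣p∣≤∣q∣ touching⊆incident ⟩
            degree G x                ≡⟨ sym (G.∣neighbours∣≡degree x) ⟩
            ∣ G.neighbours x ∣        ≤⟨ p⊆q⇒∣p∣≤∣q∣ neighbours⊆⊤-x ⟩
            ∣ ⊤ - x ∣                 ≤⟨ ∣⊤-x∣≤k ⟩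
            k                         ≤⟨ k≤1+rK 0<d ⟩
            suc rK                    <⟨ ℕₚ.≤-reflexive (ℕₚ.+-comm 2 rK) ⟩
            rK + 2                    ≤⟨ rK+2≤ρ⊤ ⟩
            ρ ⊤ ∎
            where open ℕₚ.≤-Reasoning

verticallyConnected⇒vertex : (M : GraphMatroidFamily) (G : Graph) {c : ℕ} →
                             VerticallyConnected (rank M G) (c + 2) → Fin (n G)
verticallyConnected⇒vertex M G {c} (c+2≤r⊤ , _) = proj₁ (ends G (Fin.fromℕ< 0<m))
  where
  open ℕₚ.≤-Reasoning
  0<m : 0 < m G
  0<m = begin-strict
    0              <⟨ s≤s z≤n ⟩
    2              ≤⟨ ℕₚ.m≤n+m 2 c ⟩
    c + 2          ≤⟨ c+2≤r⊤ ⟩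
    rank M G ⊤     ≤⟨ IsMatroidRank.bounded (matroid M G) ⊤ ⟩
    ∣ ⊤ {m G} ∣    ≡⟨ ∣⊤∣≡n (m G) ⟩
    m G ∎

proposition3p5 :
    (M : GraphMatroidFamily) → Nontrivial M → Unbounded M →
    (d t : ℕ) → IsDimensionality M d → IsThreshold M d t →
    (k : ℕ) → t ≤ k →
    (G : Graph) → NoIsolated G →
    (K : Graph) → IsComplete K → n K ≡ k →
    VerticallyConnected (rank M G) (r M K + 2) →
    KConnected G (k + 1)
proposition3p5 M _ unbounded d t dim thr k t≤k G noIsolated K K-complete K-size vc
  with largeCompleteGraph M unbounded (n G + k + r M K)
... | H , H-complete , N<nH , N<rH = enoughVertices , noSmallSeparator
  where
  -- Nontriviality (the unnamed argument) is implied by the circuit that IsDimensionality provides.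
  open ConnectivityArgument M dim thr t≤k K K-complete K-size
  nG+k≤nH : n G + k ≤ n H
  nG+k≤nH = ℕₚ.m+n≤o⇒m≤o (n G + k) (ℕₚ.<⇒≤ N<nH)
  open Host H H-complete (ℕₚ.m+n≤o⇒n≤o (n G) nG+k≤nH)
  open Embedded G (ℕₚ.m+n≤o⇒m≤o (n G) nG+k≤nH)
  0<d′ : 0 < d
  0<d′ = 0<d (ℕₚ.≤-<-trans (ℕₚ.m≤n+m rK _) N<rH)
  noSplit : ∀ {X} → ¬ MatroidRank.SmallSplit (matroid M G) rK X
  noSplit = MatroidRank.verticallyConnected⇒¬smallSplit (matroid M G) vc
  enoughVertices : k + 1 < n G
  enoughVertices = ℕₚ.≰⇒> λ nG≤k+1 →
    noSplit (fewVertices⇒smallSplit 0<d′ noIsolated (proj₁ vc) nG≤k+1 (verticallyConnected⇒vertex M G vc))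
  noSmallSeparator : ∀ S → ∣ S ∣ < k + 1 → ∀ u v → u ∉ S → v ∉ S → Reach G S u v
  noSmallSeparator S ∣S∣<k+1 u v _ v∉S with Reachability.reach-or-separated G S u v
  ... | inj₁ reach = reach
  ... | inj₂ (A , u∈A , v∉A , closed) = contradiction (separator⇒smallSplit 0<d′ noIsolated ∣S∣<k+1 closed v∉S u∈A v∉A) noSplit
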